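{- Let $v\in\{0,1\}^m$, $\eta$ a vector of positive integers of length $\zeta^v(m)$, and $k=|\{j:v(j)=0\}|+\sum_i\eta(i)$. Let $D_1,\dots,D_r$ be directed graphs with $V(D_i)=\{d^i_1,\dots,d^i_{n_i}\}$, and let $\phi_i:V(D_i)\to\{1,\dots,k\}$ be injective functions with $\phi_i(V(D_i))\cap\phi_j(V(D_j))=\emptyset$ for $i\ne j$, such that each $D_i$ is $(v,\eta,\phi_i)$-proper. Then for every $c>0$ there exist $\lambda_0>0$ and $c_1>0$ such that for every tournament $T$, every $0<\lambda\le\lambda_0$ and every $(v,\eta,c,\lambda)$-m-sequence $\chi$ in $T$ with $l(\chi)=(T_1,\dots,T_k)$, either $\chi$ contains a $c_1$-strong pair, or there exist vertices $x^i_j\in T_{\phi_i(d^i_j)}$ ($1\le i\le r$, $1\le j\le n_i$) such that: (a) for every $i$, if $(d^i_a,d^i_b)$ is an edge of $D_i$ then $(x^i_a,x^i_b)$ is an edge of $T$; and (b) for all $i\ne i'$ and all $a,b$ with $\phi_i(d^i_a)>\phi_{i'}(d^{i'}_b)$, $(x^i_a,x^{i'}_b)$ is not an edge of $T$.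
   Context: Tournaments are finite; transitive = no directed cycle; $tr(T)$ = maximum size of a transitive subtournament of $T$. $V_1$ is complete to $V_2$ if every vertex of $V_1$ has an edge to every vertex of $V_2$. For disjoint nonempty $X,Y$, $d(X,Y)=e_{X,Y}/(|X||Y|)$, $e_{X,Y}$ = number of edges $(x,y)$ with $x\in X,y\in Y$. $\zeta^v(i)=|\{j\le i:v(j)=1\}|$. For a tournament $T$, $c>0$, $0\le\lambda<1$, a $(v,\eta,c,\lambda)$-m-sequence in $T$ is a sequence $\chi=(S_1,\dots,S_m)$ of pairwise disjoint subsets of $V(T)$ such that: if $v(i)=1$, $S_i$ induces a transitive subtournament partitioned into $S_{i,1},\dots,S_{i,\eta(\zeta^v(i))}$ with $S_{i,a}$ complete to $S_{i,b}$ for $a<b$ and $|S_{i,a}|\ge c\,tr(T)$; if $v(i)=0$, $|S_i|\ge c|T|$; $d(S_i,S_j)\ge1-\lambda$ for $i<j$. Its long representation $l(\chi)=(T_1,\dots,T_k)$ replaces each $S_i$ with $v(i)=1$ by $S_{i,1},\dots,S_{i,\eta(\zeta^v(i))}$ in order; $V(\chi)=\bigcup S_i$. A $c'$-strong pair in $\chi$ is a pair $(A,B)$ of disjoint subsets of $V(\chi)$ with $|A|\ge c'|T|$, either $|B|\ge c'|T|$ or ($B$ transitive and $|B|\ge c'\,tr(T)$), and $d(A,B)=1$ or $d(B,A)=1$. A directed graph $D$ with $V(D)=\{d_1,\dots,d_n\}$ and injective $\phi:V(D)\to\{1,\dots,k\}$ is $(v,\eta,\phi)$-proper if for every $c>0$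 there is $c_1>0$ (depending only on $v,\eta,c$) such that for every tournament $T$, every $0\le\lambda<1$ and every $(v,\eta,c,\lambda)$-m-sequence $\chi$ in $T$ with $l(\chi)=(T_1,\dots,T_k)$, either there exist $x_j\in T_{\phi(d_j)}$ ($1\le j\le n$) such that $(x_a,x_b)$ is an edge of $T$ whenever $(d_a,d_b)$ is an edge of $D$, or $\chi$ contains a $c_1$-strong pair. -}

module Defs where

open import Data.Nat as ℕ using (ℕ; zero; suc; _+_)
open import Data.Integer using (+_)
open import Data.Rational as ℚ using (ℚ; _/_; 0ℚ; 1ℚ)
open import Data.Bool using (Bool; true; false; not; _∧_; if_then_else_)
open import Data.Fin using (Fin; zero; suc; inject₁; fromℕ; _<_; _>_)
open import Data.Fin.Properties using (_≟_)
open import Data.Vec using (Vec; []; _∷_; lookup; map; allFin; _++_)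
open import Data.Vec.Relation.Unary.All using (All)
open import Data.Product using (Σ; _×_; _,_; proj₁; proj₂; ∃)
open import Data.Sum using (_⊎_)
open import Relation.Nullary using (¬_; does)
open import Relation.Binary.PropositionalEquality using (_≡_; _≢_; refl; cong)
open import Function.Definitions using (Injective)

ℕ→ℚ : ℕ → ℚ
ℕ→ℚ n = (+ n) / 1

sumFin : ∀ {N} → (Fin N → ℕ) → ℕ
sumFin {zero}  f = 0
sumFin {suc N} f = f zero + sumFin (λ x → f (suc x))

-- subsets of Fin N are represented by characteristic functions
VSet : ℕ → Set
VSet N = Fin N → Bool

card : ∀ {N} → VSet N → ℕ
card X = sumFin (λ x → if X x then 1 else 0)

-- Tournaments (vertex set Fin N, adj x y = true iff (x,y) is an edge)

record Tournament : Set where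
  field
    N     : ℕ
    adj   : Fin N → Fin N → Bool
    irrefl : ∀ x → adj x x ≡ false
    tourn  : ∀ x y → x ≢ y → adj x y ≡ not (adj y x)
open Tournament public

Edge : (T : Tournament) → Fin (N T) → Fin (N T) → Set
Edge T x y = adj T x y ≡ true

DirCycleIn : (T : Tournament) → VSet (N T) → Set
DirCycleIn T S =
  Σ ℕ λ ℓ → Σ (Fin (suc ℓ) → Fin (N T)) λ f →
    Injective _≡_ _≡_ f
    × (∀ i → S (f i) ≡ true)
    × (∀ (i : Fin ℓ) → Edge T (f (inject₁ i)) (f (suc i)))
    × Edge T (f (fromℕ ℓ)) (f zero)

IsTransitive : (T : Tournament) → VSet (N T) → Set
IsTransitive T S = ¬ DirCycleIn T S

IsTr : (T : Tournament) → ℕ → Set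
IsTr T t = (Σ (VSet (N T)) λ S → IsTransitive T S × card S ≡ t)
         × (∀ S → IsTransitive T S → card S ℕ.≤ t)

CompleteTo : (T : Tournament) → VSet (N T) → VSet (N T) → Set
CompleteTo T V₁ V₂ = ∀ x y → V₁ x ≡ true → V₂ y ≡ true → Edge T x y

Disjoint : ∀ {N} → VSet N → VSet N → Set
Disjoint X Y = ∀ x → X x ≡ true → Y x ≡ false

Nonempty : ∀ {N} → VSet N → Set
Nonempty X = ∃ λ x → X x ≡ true

Subset⊆ : ∀ {N} → VSet N → VSet N → Set
Subset⊆ X Y = ∀ x → X x ≡ true → Y x ≡ true

eCount : (T : Tournament) → VSet (N T) → VSet (N T) → ℕ
eCount T X Y = sumFin λ x → sumFin λ y → if X x ∧ Y y ∧ adj T x y then 1 else 0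

-- d(X,Y) ≥ q   (d defined for nonempty X,Y; d = e/(|X||Y|))
DensityGE : (T : Tournament) → VSet (N T) → VSet (N T) → ℚ → Set
DensityGE T X Y q = Nonempty X × Nonempty Y
  × q ℚ.* (ℕ→ℚ (card X ℕ.* card Y)) ℚ.≤ ℕ→ℚ (eCount T X Y)

DensityOne : (T : Tournament) → VSet (N T) → VSet (N T) → Set
DensityOne T X Y = Nonempty X × Nonempty Y × eCount T X Y ≡ card X ℕ.* card Y

-- v ∈ {0,1}^m (false = 0, true = 1), η, k and the long representation

ones : ∀ {m} → Vec Bool m → ℕ
ones []          = 0
ones (false ∷ v) = ones v
ones (true  ∷ v) = suc (ones v)

zeros : ∀ {m} → Vec Bool m → ℕ
zeros []          = 0
zeros (false ∷ v) = suc (zeros v)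
zeros (true  ∷ v) = zeros v

vsum : ∀ {n} → Vec ℕ n → ℕ
vsum []       = 0
vsum (x ∷ xs) = x + vsum xs

kOf : ∀ {m} (v : Vec Bool m) → Vec ℕ (ones v) → ℕ
kOf v η = zeros v + vsum η

-- the same number, computed block by block (length of the long representation)
kRec : ∀ {m} (v : Vec Bool m) → Vec ℕ (ones v) → ℕ
kRec []          η       = 0
kRec (false ∷ v) η       = suc (kRec v η)
kRec (true  ∷ v) (e ∷ η) = e + kRec v η

kRec≡kOf : ∀ {m} (v : Vec Bool m) (η : Vec ℕ (ones v)) → kRec v η ≡ kOf v η
kRec≡kOf []          []      = refl
kRec≡kOf (false ∷ v) η       = cong suc (kRec≡kOf v η)
kRec≡kOf (true  ∷ v) (e ∷ η) rewrite kRec≡kOf v η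
  = sym+ e (zeros v) (vsum η)
  where
  open import Data.Nat.Properties using (+-assoc; +-comm)
  open import Relation.Binary.PropositionalEquality using (trans; sym)
  sym+ : ∀ a b c → a + (b + c) ≡ b + (a + c)
  sym+ a b c = trans (sym (+-assoc a b c))
                 (trans (cong (_+ c) (+-comm a b)) (+-assoc b a c))

-- labels of the long representation, in order: entry (i , a) means
-- "part a (0-based) of block S_i" (a = 0 for blocks with v(i)=0)
labelsRec : ∀ {m} (v : Vec Bool m) (η : Vec ℕ (ones v)) → Vec (Fin m × ℕ) (kRec v η)
labelsRec []          η       = []
labelsRec (false ∷ v) η       = (zero , 0) ∷ map (λ p → suc (proj₁ p) , proj₂ p) (labelsRec v η)
labelsRec (true  ∷ v) (e ∷ η) =
  map (λ a → zero , Data.Fin.toℕ a) (allFin e)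
  ++ map (λ p → suc (proj₁ p) , proj₂ p) (labelsRec v η)

castK : ∀ {m} (v : Vec Bool m) (η : Vec ℕ (ones v)) → Fin (kOf v η) → Fin (kRec v η)
castK v η j = Data.Fin.cast (Relation.Binary.PropositionalEquality.sym (kRec≡kOf v η)) j

blockOf : ∀ {m} (v : Vec Bool m) (η : Vec ℕ (ones v)) → Fin (kOf v η) → Fin m
blockOf v η j = proj₁ (lookup (labelsRec v η) (castK v η j))

partOf : ∀ {m} (v : Vec Bool m) (η : Vec ℕ (ones v)) → Fin (kOf v η) → ℕ
partOf v η j = proj₂ (lookup (labelsRec v η) (castK v η j))

-- m-sequences, given via their long representation Ts = l(χ) = (T_1,…,T_k)

anyFin : ∀ {k} → (Fin k → Bool) → Bool
anyFin {zero}  f = false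
anyFin {suc k} f = f zero Data.Bool.∨ anyFin (λ j → f (suc j))

blockSet : ∀ {m} (v : Vec Bool m) (η : Vec ℕ (ones v)) (T : Tournament)
  → (Fin (kOf v η) → VSet (N T)) → Fin m → VSet (N T)
blockSet v η T Ts i x = anyFin (λ j → does (blockOf v η j ≟ i) ∧ Ts j x)

unionAll : ∀ {k} (T : Tournament) → (Fin k → VSet (N T)) → VSet (N T)
unionAll T Ts x = anyFin (λ j → Ts j x)

-- Ts is the long representation of a (v,η,c,λ)-m-sequence in T, where t = tr(T)
record IsMSeq {m} (v : Vec Bool m) (η : Vec ℕ (ones v)) (c λ' : ℚ)
              (T : Tournament) (t : ℕ) (Ts : Fin (kOf v η) → VSet (N T)) : Set where
  field
    -- all parts pairwise disjoint (so the S_i are pairwise disjoint and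
    -- the S_{i,a} partition S_i)
    disjoint : ∀ j j' → j ≢ j' → Disjoint (Ts j) (Ts j')
    transBlock : ∀ i → lookup v i ≡ true → IsTransitive T (blockSet v η T Ts i)
    ordered : ∀ j j' → blockOf v η j ≡ blockOf v η j' → lookup v (blockOf v η j) ≡ true
            → partOf v η j ℕ.< partOf v η j' → CompleteTo T (Ts j) (Ts j')
    bigPart : ∀ j → lookup v (blockOf v η j) ≡ true
            → c ℚ.* ℕ→ℚ t ℚ.≤ ℕ→ℚ (card (Ts j))
    bigBlock : ∀ i → lookup v i ≡ false
            → c ℚ.* ℕ→ℚ (N T) ℚ.≤ ℕ→ℚ (card (blockSet v η T Ts i))
    dense : ∀ i i' → i < i'
          → DensityGE T (blockSet v η T Ts i) (blockSet v η T Ts i') (1ℚ ℚ.- λ')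

HasStrongPair : ∀ {k} (c' : ℚ) (T : Tournament) (t : ℕ) → (Fin k → VSet (N T)) → Set
HasStrongPair c' T t Ts = Σ (VSet (N T)) λ A → Σ (VSet (N T)) λ B →
    Disjoint A B × Subset⊆ A (unionAll T Ts) × Subset⊆ B (unionAll T Ts)
  × c' ℚ.* ℕ→ℚ (N T) ℚ.≤ ℕ→ℚ (card A)
  × ( c' ℚ.* ℕ→ℚ (N T) ℚ.≤ ℕ→ℚ (card B)
    ⊎ (IsTransitive T B × c' ℚ.* ℕ→ℚ t ℚ.≤ ℕ→ℚ (card B)))
  × (DensityOne T A B ⊎ DensityOne T B A)

Digraph : ℕ → Set
Digraph n = Fin n → Fin n → Bool

IsProper : ∀ {m} (v : Vec Bool m) (η : Vec ℕ (ones v)) {n} (D : Digraph n)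
  → (Fin n → Fin (kOf v η)) → Set
IsProper v η {n} D φ =
  ∀ (c : ℚ) → 0ℚ ℚ.< c →
  Σ ℚ λ c₁ → 0ℚ ℚ.< c₁ ×
   (∀ (T : Tournament) (t : ℕ) → IsTr T t →
    ∀ (λ' : ℚ) → 0ℚ ℚ.≤ λ' → λ' ℚ.< 1ℚ →
    ∀ (Ts : Fin (kOf v η) → VSet (N T)) → IsMSeq v η c λ' T t Ts →
      (Σ (Fin n → Fin (N T)) λ x →
          (∀ a → Ts (φ a) (x a) ≡ true)
        × (∀ a b → D a b ≡ true → Edge T (x a) (x b)))
      ⊎ HasStrongPair c₁ T t Ts)

-- Fix q ≥ 1 with c ≥ 1/q.  An edge between two blocks S_b, S_j is backward if it points from the
-- later block to the earlier one.  For λ ≤ 1/(D·M) every pair of blocks spans few backward edges,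
-- so by Markov's inequality all but |S_b|/(4q) vertices of S_b are typical: they have at most
-- |S_j|/M backward neighbours in every block S_j.  The digraphs are embedded greedily: given the
-- typical vertices W chosen so far, remove from each block its atypical vertices and those with a
-- backward edge to W.  At most |S_b|/(2q) vertices go, so the rest is an m-sequence with constant
-- 1/(2q) and some λ'' < 1 (one forward edge between blocks suffices), and properness of the next
-- digraph yields either a strong pair, which is one of χ, or an embedding, whose vertices join W.
-- Condition (b) holds as chosen vertices are joined by no backward edge and, inside a transitive
-- block, earlier parts are complete to later ones.

module Submission where


-- The embedding ℕ → ℚ and the rational constants of the proof
module Rationals where

  open import Defs using (ℕ→ℚ)
  open import Data.Nat as ℕ using (ℕ; zero; suc)
  import Data.Nat.Properties as ℕP
  open import Data.Integer as ℤ using (+_; +[1+_])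
  import Data.Integer.Properties as ℤP
  open import Data.Rational as ℚ using (ℚ; mkℚ; 0ℚ; 1ℚ; toℚᵘ; 1/_; _≤_; _<_)
  open import Data.Rational.Properties
  open import Data.Rational.Solver using (module +-*-Solver)
  import Data.Rational.Unnormalised as U
  import Data.Rational.Unnormalised.Properties as UP
  import Data.Nat.Coprimality as Coprime
  open import Data.Product using (Σ; _,_)
  open import Data.Sum using (inj₁; inj₂)
  import Data.Fin as F
  open import Relation.Binary.PropositionalEquality

  toℚᵘ-ℕ→ℚ : ∀ n → toℚᵘ (ℕ→ℚ n) ≡ U.mkℚᵘ (+ n) 0
  toℚᵘ-ℕ→ℚ n rewrite ↥p/↧p≡p (mkℚ (+ n) 0 (Coprime.sym (Coprime.1-coprimeTo n))) = refl

  ℕ→ℚ-homo-+ : ∀ a b → ℕ→ℚ (a ℕ.+ b) ≡ ℕ→ℚ a ℚ.+ ℕ→ℚ b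
  ℕ→ℚ-homo-+ a b = toℚᵘ-injective (begin
    toℚᵘ (ℕ→ℚ (a ℕ.+ b))              ≡⟨ toℚᵘ-ℕ→ℚ (a ℕ.+ b) ⟩
    U.mkℚᵘ (+ (a ℕ.+ b)) 0            ≈⟨ U.*≡* (cong (ℤ._* + 1) (sym sum-num)) ⟩
    U.mkℚᵘ (+ a) 0 U.+ U.mkℚᵘ (+ b) 0 ≡⟨ sym (cong₂ U._+_ (toℚᵘ-ℕ→ℚ a) (toℚᵘ-ℕ→ℚ b)) ⟩
    toℚᵘ (ℕ→ℚ a) U.+ toℚᵘ (ℕ→ℚ b)     ≈⟨ UP.≃-sym (toℚᵘ-homo-+ (ℕ→ℚ a) (ℕ→ℚ b)) ⟩
    toℚᵘ (ℕ→ℚ a ℚ.+ ℕ→ℚ b)           ∎)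
    where
    open UP.≃-Reasoning
    sum-num : (+ a) ℤ.* + 1 ℤ.+ (+ b) ℤ.* + 1 ≡ + (a ℕ.+ b)
    sum-num = trans (cong₂ ℤ._+_ (ℤP.*-identityʳ (+ a)) (ℤP.*-identityʳ (+ b))) (sym (ℤP.pos-+ a b))

  ℕ→ℚ-homo-* : ∀ a b → ℕ→ℚ (a ℕ.* b) ≡ ℕ→ℚ a ℚ.* ℕ→ℚ b
  ℕ→ℚ-homo-* a b = toℚᵘ-injective (begin
    toℚᵘ (ℕ→ℚ (a ℕ.* b))              ≡⟨ toℚᵘ-ℕ→ℚ (a ℕ.* b) ⟩
    U.mkℚᵘ (+ (a ℕ.* b)) 0            ≈⟨ U.*≡* (cong (ℤ._* + 1) (ℤP.pos-* a b)) ⟩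
    U.mkℚᵘ (+ a) 0 U.* U.mkℚᵘ (+ b) 0 ≡⟨ sym (cong₂ U._*_ (toℚᵘ-ℕ→ℚ a) (toℚᵘ-ℕ→ℚ b)) ⟩
    toℚᵘ (ℕ→ℚ a) U.* toℚᵘ (ℕ→ℚ b)     ≈⟨ UP.≃-sym (toℚᵘ-homo-* (ℕ→ℚ a) (ℕ→ℚ b)) ⟩
    toℚᵘ (ℕ→ℚ a ℚ.* ℕ→ℚ b)           ∎)
    where open UP.≃-Reasoning

  ℕ→ℚ-mono-≤ : ∀ {a b} → a ℕ.≤ b → ℕ→ℚ a ≤ ℕ→ℚ b
  ℕ→ℚ-mono-≤ {a} {b} a≤b = toℚᵘ-cancel-≤ (subst₂ U._≤_ (sym (toℚᵘ-ℕ→ℚ a)) (sym (toℚᵘ-ℕ→ℚ b))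
    (U.*≤* (ℤP.*-monoʳ-≤-nonNeg (+ 1) (ℤ.+≤+ a≤b))))

  ℕ→ℚ-cancel-≤ : ∀ {a b} → ℕ→ℚ a ≤ ℕ→ℚ b → a ℕ.≤ b
  ℕ→ℚ-cancel-≤ {a} {b} a≤b with subst₂ U._≤_ (toℚᵘ-ℕ→ℚ a) (toℚᵘ-ℕ→ℚ b) (toℚᵘ-mono-≤ a≤b)
  ... | U.*≤* a*1≤b*1 with subst₂ ℤ._≤_ (ℤP.*-identityʳ (+ a)) (ℤP.*-identityʳ (+ b)) a*1≤b*1
  ...   | ℤ.+≤+ le = le

  ℕ→ℚ-nonNeg : ∀ n → ℚ.NonNegative (ℕ→ℚ n)
  ℕ→ℚ-nonNeg n = ℚ.nonNegative (ℕ→ℚ-mono-≤ {0} {n} ℕ.z≤n)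

  one≤num/den*den : ∀ p d .(cop : Coprime.Coprime (suc p) (suc d)) → 1ℚ ≤ mkℚ +[1+ p ] d cop ℚ.* ℕ→ℚ (suc d)
  one≤num/den*den p d cop = toℚᵘ-cancel-≤ (UP.≤-respʳ-≃ (UP.≃-sym (toℚᵘ-homo-* c (ℕ→ℚ (suc d))))
    (subst (λ z → toℚᵘ 1ℚ U.≤ toℚᵘ c U.* z) (sym (toℚᵘ-ℕ→ℚ (suc d)))
      (U.*≤* (ℤ.+≤+ (ℕ.s≤s d≤num*den)))))
    where
    c : ℚ
    c = mkℚ +[1+ p ] d cop
    d≤num*den : d ℕ.* 1 ℕ.+ 0 ℕ.≤ (d ℕ.+ p ℕ.* suc d) ℕ.* 1
    d≤num*den rewrite ℕP.+-identityʳ (d ℕ.* 1) | ℕP.*-identityʳ d | ℕP.*-identityʳ (d ℕ.+ p ℕ.* suc d) =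
      ℕP.m≤m+n d _

  -- For c > 0 there is q ≥ 1 (the denominator of c) with c · a ≤ b ⇒ a ≤ q · b
  fractionBound : ∀ c → 0ℚ < c → Σ ℕ λ q' → ∀ a b → c ℚ.* ℕ→ℚ a ≤ ℕ→ℚ b → a ℕ.≤ suc q' ℕ.* b
  fractionBound c 0<c = bound c (ℚ.positive 0<c)
    where
    bound : ∀ c → ℚ.Positive c → Σ ℕ λ q' → ∀ a b → c ℚ.* ℕ→ℚ a ≤ ℕ→ℚ b → a ℕ.≤ suc q' ℕ.* b
    bound c@(mkℚ +[1+ p ] d cop) _ = d , λ a b ca≤b → ℕ→ℚ-cancel-≤ (begin
      ℕ→ℚ a                           ≡⟨ sym (*-identityˡ (ℕ→ℚ a)) ⟩
      1ℚ ℚ.* ℕ→ℚ a                    ≤⟨ *-monoʳ-≤-nonNeg (ℕ→ℚ a) {{ℕ→ℚ-nonNeg a}} (one≤num/den*den p d cop) ⟩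
      (c ℚ.* ℕ→ℚ (suc d)) ℚ.* ℕ→ℚ a   ≡⟨ solve 3 (λ c x y → (c :* x) :* y := (c :* y) :* x) refl c (ℕ→ℚ (suc d)) (ℕ→ℚ a) ⟩
      (c ℚ.* ℕ→ℚ a) ℚ.* ℕ→ℚ (suc d)   ≤⟨ *-monoʳ-≤-nonNeg (ℕ→ℚ (suc d)) {{ℕ→ℚ-nonNeg (suc d)}} ca≤b ⟩
      ℕ→ℚ b ℚ.* ℕ→ℚ (suc d)           ≡⟨ trans (*-comm (ℕ→ℚ b) (ℕ→ℚ (suc d))) (sym (ℕ→ℚ-homo-* (suc d) b)) ⟩
      ℕ→ℚ (suc d ℕ.* b)               ∎)
      where
      open ≤-Reasoning
      open +-*-Solver

  ℕ→ℚ-pos : ∀ n → 0ℚ < ℕ→ℚ (suc n)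
  ℕ→ℚ-pos n = toℚᵘ-cancel-< (subst (toℚᵘ 0ℚ U.<_) (sym (toℚᵘ-ℕ→ℚ (suc n))) (U.*<* (ℤ.+<+ (ℕ.s≤s ℕ.z≤n))))

  ℕ→ℚ-suc-nonZero : ∀ n → ℚ.NonZero (ℕ→ℚ (suc n))
  ℕ→ℚ-suc-nonZero n = pos⇒nonZero (ℕ→ℚ (suc n)) {{ℚ.positive (ℕ→ℚ-pos n)}}

  unitFrac : ℕ → ℚ
  unitFrac n = (1/ ℕ→ℚ (suc n)) {{ℕ→ℚ-suc-nonZero n}}

  unitFrac-pos : ∀ n → 0ℚ < unitFrac n
  unitFrac-pos n = positive⁻¹ (unitFrac n)
    {{1/pos⇒pos (ℕ→ℚ (suc n)) {{ℚ.positive (ℕ→ℚ-pos n)}}}}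

  unitFrac-inverse : ∀ n → unitFrac n ℚ.* ℕ→ℚ (suc n) ≡ 1ℚ
  unitFrac-inverse n = *-inverseˡ (ℕ→ℚ (suc n)) {{ℕ→ℚ-suc-nonZero n}}

  unitFrac-scale : ∀ n a b → a ℕ.≤ suc n ℕ.* b → unitFrac n ℚ.* ℕ→ℚ a ≤ ℕ→ℚ b
  unitFrac-scale n a b a≤ = begin
    u ℚ.* ℕ→ℚ a                      ≤⟨ *-monoˡ-≤-nonNeg u {{ℚ.nonNegative (<⇒≤ (unitFrac-pos n))}} (ℕ→ℚ-mono-≤ a≤) ⟩
    u ℚ.* ℕ→ℚ (suc n ℕ.* b)          ≡⟨ cong (u ℚ.*_) (ℕ→ℚ-homo-* (suc n) b) ⟩
    u ℚ.* (ℕ→ℚ (suc n) ℚ.* ℕ→ℚ b)    ≡⟨ sym (*-assoc u _ _) ⟩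
    (u ℚ.* ℕ→ℚ (suc n)) ℚ.* ℕ→ℚ b    ≡⟨ cong (ℚ._* ℕ→ℚ b) (unitFrac-inverse n) ⟩
    1ℚ ℚ.* ℕ→ℚ b                     ≡⟨ *-identityˡ _ ⟩
    ℕ→ℚ b                            ∎
    where
    open ≤-Reasoning
    u : ℚ
    u = unitFrac n

  unitFrac≤1 : ∀ n → unitFrac n ≤ 1ℚ
  unitFrac≤1 n = subst (_≤ 1ℚ) (*-identityʳ (unitFrac n)) (unitFrac-scale n 1 1 (ℕ.s≤s ℕ.z≤n))

  fewReversePairs : ∀ L λ' → λ' ≤ unitFrac L → ∀ a e B →
                    (1ℚ ℚ.- λ') ℚ.* ℕ→ℚ a ≤ ℕ→ℚ e → e ℕ.+ B ≡ a → suc L ℕ.* B ℕ.≤ a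
  fewReversePairs L λ' λ≤ a e B dense e+B≡a = ℕ→ℚ-cancel-≤ (begin
    ℕ→ℚ (suc L ℕ.* B)                 ≡⟨ ℕ→ℚ-homo-* (suc L) B ⟩
    sL ℚ.* ℕ→ℚ B                      ≡⟨ cong (sL ℚ.*_) B≡a-e ⟩
    sL ℚ.* (ℕ→ℚ a ℚ.- ℕ→ℚ e)          ≤⟨ *-monoˡ-≤-nonNeg sL {{ℕ→ℚ-nonNeg (suc L)}} a-e≤λa ⟩
    sL ℚ.* (λ' ℚ.* ℕ→ℚ a)             ≤⟨ *-monoˡ-≤-nonNeg sL {{ℕ→ℚ-nonNeg (suc L)}}
                                          (*-monoʳ-≤-nonNeg (ℕ→ℚ a) {{ℕ→ℚ-nonNeg a}} λ≤) ⟩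
    sL ℚ.* (unitFrac L ℚ.* ℕ→ℚ a)     ≡⟨ sym (*-assoc sL (unitFrac L) _) ⟩
    (sL ℚ.* unitFrac L) ℚ.* ℕ→ℚ a     ≡⟨ cong (ℚ._* ℕ→ℚ a) (trans (*-comm sL (unitFrac L)) (unitFrac-inverse L)) ⟩
    1ℚ ℚ.* ℕ→ℚ a                      ≡⟨ *-identityˡ _ ⟩
    ℕ→ℚ a                             ∎)
    where
    open ≤-Reasoning
    open +-*-Solver
    sL : ℚ
    sL = ℕ→ℚ (suc L)
    B≡a-e : ℕ→ℚ B ≡ ℕ→ℚ a ℚ.- ℕ→ℚ e
    B≡a-e = trans (sym (solve 2 (λ x y → (y :+ x) :- y := x) refl (ℕ→ℚ B) (ℕ→ℚ e)))
                  (cong (ℚ._- ℕ→ℚ e) (trans (sym (ℕ→ℚ-homo-+ e B)) (cong ℕ→ℚ e+B≡a)))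
    a-e≤λa : ℕ→ℚ a ℚ.- ℕ→ℚ e ≤ λ' ℚ.* ℕ→ℚ a
    a-e≤λa = begin
      ℕ→ℚ a ℚ.- ℕ→ℚ e                   ≤⟨ +-monoʳ-≤ (ℕ→ℚ a) (neg-antimono-≤ dense) ⟩
      ℕ→ℚ a ℚ.- (1ℚ ℚ.- λ') ℚ.* ℕ→ℚ a   ≡⟨ solve 2 (λ x l → x :- ((con 1ℚ :- l) :* x) := l :* x) refl (ℕ→ℚ a) λ' ⟩
      λ' ℚ.* ℕ→ℚ a                      ∎

  -- The parameter 1 - 1/(P+1): it lies in [0,1), and a single edge between sets with at most
  -- P + 1 ordered pairs already has density at least 1/(P+1) = 1 - (1 - 1/(P+1)).
  nearlyOne : ℕ → ℚ
  nearlyOne P = 1ℚ ℚ.- unitFrac P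

  nearlyOne-nonNeg : ∀ P → 0ℚ ≤ nearlyOne P
  nearlyOne-nonNeg P = begin
    0ℚ                          ≡⟨ sym (+-inverseʳ (unitFrac P)) ⟩
    unitFrac P ℚ.- unitFrac P   ≤⟨ +-monoˡ-≤ (ℚ.- unitFrac P) (unitFrac≤1 P) ⟩
    nearlyOne P                 ∎
    where open ≤-Reasoning

  nearlyOne<1 : ∀ P → nearlyOne P < 1ℚ
  nearlyOne<1 P = begin-strict
    nearlyOne P                  ≡⟨ sym (+-identityʳ (nearlyOne P)) ⟩
    nearlyOne P ℚ.+ 0ℚ           <⟨ +-monoʳ-< (nearlyOne P) (unitFrac-pos P) ⟩
    nearlyOne P ℚ.+ unitFrac P   ≡⟨ solve 1 (λ x → (con 1ℚ :- x) :+ x := con 1ℚ) refl (unitFrac P) ⟩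
    1ℚ                           ∎
    where
    open ≤-Reasoning
    open +-*-Solver

  nearlyOne-dense : ∀ P a e → a ℕ.≤ suc P → 1 ℕ.≤ e → (1ℚ ℚ.- nearlyOne P) ℚ.* ℕ→ℚ a ≤ ℕ→ℚ e
  nearlyOne-dense P a e a≤ 1≤e = begin
    (1ℚ ℚ.- nearlyOne P) ℚ.* ℕ→ℚ a ≡⟨ cong (ℚ._* ℕ→ℚ a) (solve 1 (λ x → con 1ℚ :- (con 1ℚ :- x) := x) refl (unitFrac P)) ⟩
    unitFrac P ℚ.* ℕ→ℚ a           ≤⟨ unitFrac-scale P a 1 (subst (a ℕ.≤_) (sym (ℕP.*-identityʳ (suc P))) a≤) ⟩
    ℕ→ℚ 1                          ≤⟨ ℕ→ℚ-mono-≤ 1≤e ⟩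
    ℕ→ℚ e                          ∎
    where
    open ≤-Reasoning
    open +-*-Solver

  -- The minimum of finitely many rationals (1 for the empty family)
  minimum : ∀ {r} → (F.Fin r → ℚ) → ℚ
  minimum {zero}  f = 1ℚ
  minimum {suc r} f = f F.zero ℚ.⊓ minimum (λ i → f (F.suc i))

  minimum≤ : ∀ {r} (f : F.Fin r → ℚ) i → minimum f ≤ f i
  minimum≤ f F.zero    = p⊓q≤p (f F.zero) _
  minimum≤ f (F.suc i) = ≤-trans (p⊓q≤q (f F.zero) _) (minimum≤ (λ j → f (F.suc j)) i)

  minimum-pos : ∀ {r} (f : F.Fin r → ℚ) → (∀ i → 0ℚ < f i) → 0ℚ < minimum f
  minimum-pos {zero}  f _     = positive⁻¹ 1ℚ
  minimum-pos {suc r} f f>0 with ≤-total (f F.zero) (minimum (λ i → f (F.suc i)))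
  ... | inj₁ f₀≤ rewrite p≤q⇒p⊓q≡p f₀≤ = f>0 F.zero
  ... | inj₂ ≥f₀ rewrite p≥q⇒p⊓q≡q ≥f₀ = minimum-pos (λ i → f (F.suc i)) (λ i → f>0 (F.suc i))


-- Finite sums over Fin N (via the library's sums over a semiring) and cardinalities of subsets
module FiniteSums where

  open import Defs using (sumFin; VSet; card; Subset⊆; anyFin)
  open import Data.Nat as ℕ using (ℕ; zero; suc; _+_; _*_; _≤_; _<_; z≤n; s≤s)
  import Data.Nat.Properties as ℕP
  open import Data.Bool using (Bool; true; false; not; _∧_; _∨_; if_then_else_; T)
  open import Data.Bool.Properties using (∧-zeroʳ)
  open import Data.Fin using (Fin; zero; suc)
  open import Data.Product using (_×_; _,_; ∃)
  open import Relation.Binary.PropositionalEquality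
  import Algebra.Properties.Semiring.Sum ℕP.+-*-semiring as Σ

  -- sumFin is the library's sum, so it inherits the laws of finite sums
  sumFin≡sum : ∀ {N} (f : Fin N → ℕ) → sumFin f ≡ Σ.sum f
  sumFin≡sum {zero}  f = refl
  sumFin≡sum {suc N} f = cong (f zero +_) (sumFin≡sum (λ x → f (suc x)))

  sumFin-cong : ∀ {N} {f g : Fin N → ℕ} → (∀ x → f x ≡ g x) → sumFin f ≡ sumFin g
  sumFin-cong {f = f} {g} f≗g =
    trans (sumFin≡sum f) (trans (Σ.sum-cong-≗ {x = f} {y = g} f≗g) (sym (sumFin≡sum g)))

  sumFin-mono : ∀ {N} {f g : Fin N → ℕ} → (∀ x → f x ≤ g x) → sumFin f ≤ sumFin g
  sumFin-mono {zero}  f≤g = z≤n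
  sumFin-mono {suc N} f≤g = ℕP.+-mono-≤ (f≤g zero) (sumFin-mono (λ x → f≤g (suc x)))

  sumFin-zero : ∀ {N} → sumFin {N} (λ _ → 0) ≡ 0
  sumFin-zero {N} = trans (sumFin≡sum {N} (λ _ → 0)) (Σ.sum-replicate-zero N)

  sumFin-+ : ∀ {N} (f g : Fin N → ℕ) → sumFin (λ x → f x + g x) ≡ sumFin f + sumFin g
  sumFin-+ f g = trans (sumFin≡sum (λ x → f x + g x))
    (trans (Σ.∑-distrib-+ f g) (sym (cong₂ _+_ (sumFin≡sum f) (sumFin≡sum g))))

  sumFin-*ˡ : ∀ {N} k (f : Fin N → ℕ) → sumFin (λ x → k * f x) ≡ k * sumFin f
  sumFin-*ˡ k f = trans (sumFin≡sum (λ x → k * f x))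
    (trans (sym (Σ.*-distribˡ-sum k f)) (cong (k *_) (sym (sumFin≡sum f))))

  sumFin-comm : ∀ {N M} (f : Fin N → Fin M → ℕ) →
                sumFin (λ x → sumFin (f x)) ≡ sumFin (λ y → sumFin (λ x → f x y))
  sumFin-comm f = trans (double≡ f) (trans (Σ.∑-comm f) (sym (double≡ (λ y x → f x y))))
    where
    double≡ : ∀ {N M} (g : Fin N → Fin M → ℕ) → sumFin (λ x → sumFin (g x)) ≡ Σ.sum (λ x → Σ.sum (g x))
    double≡ g = trans (sumFin≡sum (λ x → sumFin (g x))) (Σ.sum-cong-≗ {x = λ x → sumFin (g x)} (λ x → sumFin≡sum (g x)))

  term≤sumFin : ∀ {N} (f : Fin N → ℕ) x → f x ≤ sumFin f
  term≤sumFin f zero    = ℕP.m≤m+n _ _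
  term≤sumFin f (suc x) = ℕP.≤-trans (term≤sumFin (λ y → f (suc y)) x) (ℕP.m≤n+m _ (f zero))

  sumFin-*≤ : ∀ {N} (f : Fin N → ℕ) D a → (∀ x → f x * D ≤ a) → sumFin f * D ≤ N * a
  sumFin-*≤ {zero}  f D a bound = z≤n
  sumFin-*≤ {suc N} f D a bound = ℕP.≤-trans (ℕP.≤-reflexive (ℕP.*-distribʳ-+ D (f zero) _))
    (ℕP.+-mono-≤ (bound zero) (sumFin-*≤ (λ x → f (suc x)) D a (λ x → bound (suc x))))

  sumFin-positive : ∀ {N} (f : Fin N → ℕ) → 0 < sumFin f → ∃ λ x → 0 < f x
  sumFin-positive {zero}  f ()
  sumFin-positive {suc N} f 0<sum with f zero in eq
  ... | suc _ = zero , subst (0 <_) (sym eq) (s≤s z≤n)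
  ... | zero with sumFin-positive (λ x → f (suc x)) 0<sum
  ...   | x , 0<fx = suc x , 0<fx

  ind : Bool → ℕ
  ind b = if b then 1 else 0

  card-cong : ∀ {N} {X Y : VSet N} → (∀ x → X x ≡ Y x) → card X ≡ card Y
  card-cong X≗Y = sumFin-cong (λ x → cong ind (X≗Y x))

  card-mono : ∀ {N} {X Y : VSet N} → Subset⊆ X Y → card X ≤ card Y
  card-mono {X = X} X⊆Y = sumFin-mono (λ x → ind-mono (X x) (X⊆Y x))
    where
    ind-mono : ∀ a {b} → (a ≡ true → b ≡ true) → ind a ≤ ind b
    ind-mono false _   = z≤n
    ind-mono true  a⇒b rewrite a⇒b refl = ℕP.≤-refl

  card-empty : ∀ {N} (X : VSet N) → (∀ x → X x ≡ false) → card X ≡ 0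
  card-empty {N} X empty = trans (card-cong empty) (sumFin-zero {N})

  card≤N : ∀ {N} (X : VSet N) → card X ≤ N
  card≤N {N} X = subst₂ _≤_ (ℕP.*-identityʳ (card X)) (ℕP.*-identityʳ N)
    (sumFin-*≤ (λ x → ind (X x)) 1 1 (λ x → ind≤1 (X x)))
    where
    ind≤1 : ∀ b → ind b * 1 ≤ 1
    ind≤1 false = z≤n
    ind≤1 true  = ℕP.≤-refl

  card-member : ∀ {N} (X : VSet N) x → X x ≡ true → 0 < card X
  card-member X x Xx = ℕP.<-≤-trans (subst (λ b → 0 < ind b) (sym Xx) (s≤s z≤n)) (term≤sumFin (λ y → ind (X y)) x)

  card-split : ∀ {N} (X E : VSet N) → card X ≡ card (λ x → X x ∧ not (E x)) + card (λ x → X x ∧ E x)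
  card-split X E = trans (sumFin-cong (λ x → ind-split (X x) (E x)))
    (sumFin-+ (λ x → ind (X x ∧ not (E x))) (λ x → ind (X x ∧ E x)))
    where
    ind-split : ∀ a e → ind a ≡ ind (a ∧ not e) + ind (a ∧ e)
    ind-split false e     = refl
    ind-split true  false = refl
    ind-split true  true  = refl

  card-∨ : ∀ {N} (X A B : VSet N) →
           card (λ x → X x ∧ (A x ∨ B x)) ≤ card (λ x → X x ∧ A x) + card (λ x → X x ∧ B x)
  card-∨ X A B = ℕP.≤-trans (sumFin-mono (λ x → ind-∨ (X x) (A x) (B x)))
    (ℕP.≤-reflexive (sumFin-+ (λ x → ind (X x ∧ A x)) (λ x → ind (X x ∧ B x))))
    where
    ind-∨ : ∀ x a b → ind (x ∧ (a ∨ b)) ≤ ind (x ∧ a) + ind (x ∧ b)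
    ind-∨ false a     b = z≤n
    ind-∨ true  true  b = s≤s z≤n
    ind-∨ true  false b = ℕP.≤-refl

  card-escape : ∀ {N} (X E : VSet N) → card (λ x → X x ∧ E x) < card X → ∃ λ x → X x ≡ true × E x ≡ false
  card-escape X E small with sumFin-positive (λ x → ind (X x ∧ not (E x))) outside-positive
    where
    outside-positive : 0 < card (λ x → X x ∧ not (E x))
    outside-positive = ℕP.+-cancelʳ-< (card (λ x → X x ∧ E x)) 0 _
      (subst (card (λ x → X x ∧ E x) <_) (card-split X E) small)
  ... | x , 0<ind with X x in Xx | E x in Ex
  ...   | true | false = x , Xx , Ex

  anyFin-intro : ∀ {k} (f : Fin k → Bool) j → f j ≡ true → anyFin f ≡ true
  anyFin-intro f zero    fj rewrite fj = refl
  anyFin-intro f (suc j) fj with f zero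
  ... | true  = refl
  ... | false = anyFin-intro (λ j → f (suc j)) j fj

  anyFin-elim : ∀ {k} (f : Fin k → Bool) → anyFin f ≡ true → ∃ λ j → f j ≡ true
  anyFin-elim {zero}  f ()
  anyFin-elim {suc k} f any with f zero in f0
  ... | true  = zero , f0
  ... | false with anyFin-elim (λ j → f (suc j)) any
  ...   | j , fj = suc j , fj

  card-anyFin : ∀ {N k} (X : VSet N) (A : Fin N → Fin k → Bool) →
                card (λ x → X x ∧ anyFin (A x)) ≤ sumFin (λ j → card (λ x → X x ∧ A x j))
  card-anyFin {k = zero}  X A = ℕP.≤-reflexive (card-empty _ (λ x → ∧-zeroʳ (X x)))
  card-anyFin {k = suc k} X A = ℕP.≤-trans (card-∨ X (λ x → A x zero) (λ x → anyFin (λ j → A x (suc j))))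
    (ℕP.+-monoʳ-≤ _ (card-anyFin X (λ x j → A x (suc j))))

  markov : ∀ {N} (A : VSet N) (f : Fin N → ℕ) M s →
           card (λ y → A y ∧ (s ℕ.<ᵇ M * f y)) * suc s ≤ M * sumFin (λ y → if A y then f y else 0)
  markov A f M s = begin
    card (λ y → A y ∧ (s ℕ.<ᵇ M * f y)) * suc s
      ≡⟨ trans (ℕP.*-comm _ (suc s)) (sym (sumFin-*ˡ (suc s) (λ y → ind (A y ∧ (s ℕ.<ᵇ M * f y))))) ⟩
    sumFin (λ y → suc s * ind (A y ∧ (s ℕ.<ᵇ M * f y)))
      ≤⟨ sumFin-mono (λ y → pointwise (A y) (f y)) ⟩
    sumFin (λ y → M * (if A y then f y else 0))
      ≡⟨ sumFin-*ˡ M (λ y → if A y then f y else 0) ⟩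
    M * sumFin (λ y → if A y then f y else 0) ∎
    where
    open ℕP.≤-Reasoning
    pointwise : ∀ a n → suc s * ind (a ∧ (s ℕ.<ᵇ M * n)) ≤ M * (if a then n else 0)
    pointwise false n rewrite ℕP.*-zeroʳ (suc s) = z≤n
    pointwise true  n with s ℕ.<ᵇ M * n in above
    ... | false rewrite ℕP.*-zeroʳ (suc s) = z≤n
    ... | true  = ℕP.≤-trans (ℕP.≤-reflexive (ℕP.*-identityʳ (suc s)))
                             (ℕP.<ᵇ⇒< s (M * n) (subst T (sym above) _))

  <ᵇ-false⇒≥ : ∀ m n → (m ℕ.<ᵇ n) ≡ false → n ≤ m
  <ᵇ-false⇒≥ m n m≮n = ℕP.≮⇒≥ (λ m<n → subst T m≮n (ℕP.<⇒<ᵇ m<n))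


-- Natural-number estimates used in the counting arguments
module Arithmetic where

  open import Data.Nat as ℕ using (ℕ; suc; _+_; _*_; _≤_; _<_; z≤n; s≤s)
  open import Data.Nat.Properties
  open import Data.Nat.Solver using (module +-*-Solver)
  open import Relation.Binary.PropositionalEquality
  open +-*-Solver

  double : ℕ → ℕ
  double n = n + n

  -- The thresholds of the counting argument, 4q·(n + 1), for n = K (chosen vertices) and n = m (blocks)
  threshold : ℕ → ℕ → ℕ
  threshold q n = double (double q) * suc n

  -- Markov's inequality combined with a density bound: if X vertices each see more than s/M
  -- of a set of size s, they account for > X·s/M of B pairs; with B ≤ a·s/(D·M) this gives X ≤ a/D.
  markov-density : ∀ X s M B D a → X * suc s ≤ M * B → D * M * B ≤ a * s → X * D ≤ a
  markov-density X s M B D a X·s<M·B DMB≤as = *-cancelʳ-≤ (X * D) a (suc s) (begin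
    X * D * suc s ≡⟨ solve 3 (λ x d s → x :* d :* s := x :* s :* d) refl X D (suc s) ⟩
    X * suc s * D ≤⟨ *-monoˡ-≤ D X·s<M·B ⟩
    M * B * D     ≡⟨ solve 3 (λ m b d → m :* b :* d := d :* m :* b) refl M B D ⟩
    D * M * B     ≤⟨ DMB≤as ⟩
    a * s         ≤⟨ *-monoʳ-≤ a (n≤1+n s) ⟩
    a * suc s     ∎)
    where open ≤-Reasoning

  cancel-count : ∀ Y Q m ℓ a → Y * (Q * suc m) ≤ ℓ * a → ℓ ≤ suc m → Y * Q ≤ a
  cancel-count Y Q m ℓ a YQm≤ℓa ℓ≤ = *-cancelʳ-≤ (Y * Q) a (suc m) (begin
    Y * Q * suc m   ≡⟨ *-assoc Y Q (suc m) ⟩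
    Y * (Q * suc m) ≤⟨ YQm≤ℓa ⟩
    ℓ * a           ≤⟨ *-monoˡ-≤ a ℓ≤ ⟩
    suc m * a       ≡⟨ *-comm (suc m) a ⟩
    a * suc m       ∎)
    where open ≤-Reasoning

  halves : ∀ k R g w a → g * double k ≤ a → w * double k ≤ a → R ≤ g + w → R * k ≤ a
  halves k R g w a g≤ w≤ R≤ = *-cancelʳ-≤ (R * k) a 2 (begin
    R * k * 2         ≡⟨ solve 2 (λ r k → r :* k :* con 2 := r :* (k :+ k)) refl R k ⟩
    R * double k      ≤⟨ *-monoˡ-≤ (double k) R≤ ⟩
    (g + w) * double k ≡⟨ *-distribʳ-+ (double k) g w ⟩
    g * double k + w * double k ≤⟨ +-mono-≤ g≤ w≤ ⟩
    a + a             ≡⟨ solve 1 (λ a → a :+ a := a :* con 2) refl a ⟩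
    a * 2             ∎)
    where open ≤-Reasoning

  -- A set of size c ≥ N/q loses R ≤ s/(2q) ≤ N/(2q) vertices; at least N/(2q) remain
  keepsHalf : ∀ N q c c' R s → N ≤ q * c → c ≤ c' + R → R * double q ≤ s → s ≤ N → N ≤ double q * c'
  keepsHalf N q c c' R s N≤qc c≤ R≤ s≤N = +-cancelʳ-≤ N _ _ (begin
    N + N                      ≤⟨ +-mono-≤ N≤qc N≤qc ⟩
    q * c + q * c              ≡⟨ solve 2 (λ q c → q :* c :+ q :* c := (q :+ q) :* c) refl q c ⟩
    double q * c               ≤⟨ *-monoʳ-≤ (double q) c≤ ⟩
    double q * (c' + R)        ≡⟨ *-distribˡ-+ (double q) c' R ⟩
    double q * c' + double q * R ≤⟨ +-monoʳ-≤ (double q * c') (≤-trans (≤-reflexive (*-comm (double q) R)) (≤-trans R≤ s≤N)) ⟩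
    double q * c' + N          ∎)
    where open ≤-Reasoning

  smallParts< : ∀ q' R x s → R * double (suc q') ≤ s → x * double (double (suc q')) ≤ s → 0 < s → R + x < s
  smallParts< q' R x s R≤ x≤ 0<s = *-cancelˡ-< q4 (R + x) s (begin-strict
    q4 * (R + x)                  ≡⟨ solve 3 (λ r x q → (q :+ q :+ (q :+ q)) :* (r :+ x)
                                       := r :* (q :+ q) :* con 2 :+ x :* (q :+ q :+ (q :+ q))) refl R x q ⟩
    R * double q * 2 + x * q4     ≤⟨ +-mono-≤ (*-monoˡ-≤ 2 R≤) x≤ ⟩
    s * 2 + s                     <⟨ +-monoʳ-< (s * 2) (m<m+n s 0<s) ⟩
    s * 2 + (s + s)               ≡⟨ solve 1 (λ s → s :* con 2 :+ (s :+ s) := con 4 :* s) refl s ⟩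
    4 * s                         ≤⟨ *-monoˡ-≤ s 4≤q4 ⟩
    q4 * s                        ∎)
    where
    open ≤-Reasoning
    q q4 : ℕ
    q = suc q'
    q4 = double (double q)
    4≤q4 : 4 ≤ q4
    4≤q4 = +-mono-≤ (+-mono-≤ (s≤s z≤n) (s≤s z≤n)) (+-mono-≤ (s≤s z≤n) (s≤s z≤n))


-- Counting edges in tournaments
module TournamentCounts where

  open import Defs
  open FiniteSums
  open import Data.Nat using (ℕ; _+_; _*_; _≤_)
  import Data.Nat.Properties as ℕP
  open import Data.Bool using (Bool; true; false; _∧_; if_then_else_)
  open import Data.Fin as F using (Fin)
  open import Relation.Binary.PropositionalEquality
  open import Relation.Nullary using (yes; no)

  sum-card : ∀ {N} (A B : VSet N) (C : Fin N → Fin N → Bool) →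
             sumFin (λ y → if A y then card (λ z → B z ∧ C y z) else 0)
             ≡ sumFin (λ y → sumFin (λ z → ind (A y ∧ B z ∧ C y z)))
  sum-card {N} A B C = sumFin-cong per-vertex
    where
    per-vertex : ∀ y → (if A y then card (λ z → B z ∧ C y z) else 0) ≡ sumFin (λ z → ind (A y ∧ B z ∧ C y z))
    per-vertex y with A y
    ... | true  = refl
    ... | false = sym (sumFin-zero {N})

  -- Between disjoint sets every pair is joined by exactly one edge: e(X,Y) + e(Y,X) = |X|·|Y|
  eCount-complement : (T : Tournament) (X Y : VSet (N T)) → Disjoint X Y →
                      eCount T X Y + eCount T Y X ≡ card X * card Y
  eCount-complement T X Y X∩Y=∅ = begin
    eCount T X Y + eCount T Y X
      ≡⟨ cong (eCount T X Y +_) (sumFin-comm (λ x y → ind (Y x ∧ X y ∧ adj T x y))) ⟩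
    sumFin (λ x → sumFin (e x)) + sumFin (λ x → sumFin (e' x))
      ≡⟨ sym (sumFin-+ (λ x → sumFin (e x)) (λ x → sumFin (e' x))) ⟩
    sumFin (λ x → sumFin (e x) + sumFin (e' x))
      ≡⟨ sumFin-cong (λ x → sym (sumFin-+ (e x) (e' x))) ⟩
    sumFin (λ x → sumFin (λ y → e x y + e' x y))
      ≡⟨ sumFin-cong (λ x → sumFin-cong (λ y → one-edge x y)) ⟩
    sumFin (λ x → sumFin (λ y → ind (X x) * ind (Y y)))
      ≡⟨ sumFin-cong (λ x → sumFin-*ˡ (ind (X x)) (λ y → ind (Y y))) ⟩
    sumFin (λ x → ind (X x) * card Y)
      ≡⟨ trans (sumFin-cong (λ x → ℕP.*-comm (ind (X x)) (card Y))) (sumFin-*ˡ (card Y) (λ x → ind (X x))) ⟩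
    card Y * card X
      ≡⟨ ℕP.*-comm (card Y) (card X) ⟩
    card X * card Y ∎
    where
    open ≡-Reasoning
    e e' : Fin (N T) → Fin (N T) → ℕ
    e  x y = ind (X x ∧ Y y ∧ adj T x y)
    e' x y = ind (Y y ∧ X x ∧ adj T y x)
    one-edge : ∀ x y → e x y + e' x y ≡ ind (X x) * ind (Y y)
    one-edge x y with X x in Xx | Y y in Yy
    ... | false | false = refl
    ... | false | true  = refl
    ... | true  | false = refl
    ... | true  | true with x F.≟ y
    ...   | no x≢y rewrite tourn T x y x≢y with adj T y x
    ...     | true  = refl
    ...     | false = refl
    one-edge x y | true | true | yes refl with trans (sym Yy) (X∩Y=∅ x Xx)
    ...     | ()

  edge⇒eCount-pos : (T : Tournament) (X Y : VSet (N T)) → ∀ y z → X y ≡ true → Y z ≡ true → Edge T y z →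
                    1 ≤ eCount T X Y
  edge⇒eCount-pos T X Y y z Xy Yz yz = ℕP.≤-trans (ℕP.≤-reflexive (sym counted))
    (ℕP.≤-trans (term≤sumFin _ z) (term≤sumFin (λ u → sumFin (λ w → ind (X u ∧ Y w ∧ adj T u w))) y))
    where
    counted : ind (X y ∧ Y z ∧ adj T y z) ≡ 1
    counted rewrite Xy | Yz | yz = refl


-- The order of the parts T_1,…,T_k of the long representation l(χ)
module LongRepresentation where

  open import Defs
  open import Data.Nat as ℕ using (ℕ; zero; suc)
  import Data.Nat.Properties as ℕP
  open import Data.Bool using (Bool; true; false)
  open import Data.Fin as F using (Fin; zero; suc; toℕ; _↑ˡ_; _↑ʳ_; splitAt)
  import Data.Fin.Properties as FP
  open import Data.Vec as V using (Vec; _∷_; lookup)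
  import Data.Vec.Properties as VP
  open import Data.Product using (_×_; _,_; proj₁; proj₂)
  open import Data.Sum using (_⊎_; inj₁; inj₂)
  open import Data.Empty using (⊥-elim)
  open import Relation.Binary.PropositionalEquality

  Precedes : ∀ {m} (v : Vec Bool m) → Fin m × ℕ → Fin m × ℕ → Set
  Precedes v (b , a) (b' , a') = b F.< b' ⊎ (b ≡ b' × a ℕ.< a' × lookup v b ≡ true)

  shiftLabel : ∀ {m} → Fin m × ℕ → Fin (suc m) × ℕ
  shiftLabel l = suc (proj₁ l) , proj₂ l

  shiftLabel-precedes : ∀ {m} (v : Vec Bool m) z {l l'} → Precedes v l l' →
                        Precedes (z ∷ v) (shiftLabel l) (shiftLabel l')
  shiftLabel-precedes v z (inj₁ b<b')             = inj₁ (ℕ.s<s b<b')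
  shiftLabel-precedes v z (inj₂ (b≡b' , a<a' , vb)) = inj₂ (cong suc b≡b' , a<a' , vb)

  data Split (e k : ℕ) : Fin (e ℕ.+ k) → Set where
    left  : (i : Fin e) → Split e k (i ↑ˡ k)
    right : (j : Fin k) → Split e k (e ↑ʳ j)

  split : ∀ e k (p : Fin (e ℕ.+ k)) → Split e k p
  split e k p with splitAt e p in eq
  ... | inj₁ i = subst (Split e k) (FP.splitAt⁻¹-↑ˡ eq) (left i)
  ... | inj₂ j = subst (Split e k) (FP.splitAt⁻¹-↑ʳ eq) (right j)

  labelsRec-sorted : ∀ {m} (v : Vec Bool m) (η : Vec ℕ (ones v)) (p p' : Fin (kRec v η)) → p F.< p' →
                     Precedes v (lookup (labelsRec v η) p) (lookup (labelsRec v η) p')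
  labelsRec-sorted (false ∷ v) η zero (suc p') _
    rewrite VP.lookup-map p' shiftLabel (labelsRec v η) = inj₁ ℕ.z<s
  labelsRec-sorted (false ∷ v) η (suc p) (suc p') p<p'
    rewrite VP.lookup-map p shiftLabel (labelsRec v η) | VP.lookup-map p' shiftLabel (labelsRec v η)
    = shiftLabel-precedes v false (labelsRec-sorted v η p p' (ℕ.s<s⁻¹ p<p'))
  labelsRec-sorted {suc m} (true ∷ v) (e ∷ η) p p' p<p' = sorted (split e (kRec v η) p) (split e (kRec v η) p') p<p'
    where
    parts : Vec (Fin (suc m) × ℕ) e
    parts = V.map (λ a → zero , toℕ a) (V.allFin e)
    rest : Vec (Fin (suc m) × ℕ) (kRec v η)
    rest = V.map shiftLabel (labelsRec v η)
    lookup-left : ∀ i → lookup (parts V.++ rest) (i ↑ˡ kRec v η) ≡ (zero , toℕ i)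
    lookup-left i = trans (VP.lookup-++ˡ parts rest i)
      (trans (VP.lookup-map i _ (V.allFin e)) (cong (λ z → zero , toℕ z) (VP.lookup-allFin i)))
    lookup-right : ∀ j → lookup (parts V.++ rest) (e ↑ʳ j) ≡ shiftLabel (lookup (labelsRec v η) j)
    lookup-right j = trans (VP.lookup-++ʳ parts rest j) (VP.lookup-map j shiftLabel (labelsRec v η))
    sorted : ∀ {p p'} → Split e (kRec v η) p → Split e (kRec v η) p' → p F.< p' →
             Precedes (true ∷ v) (lookup (parts V.++ rest) p) (lookup (parts V.++ rest) p')
    sorted (left i) (left i') i<i' rewrite lookup-left i | lookup-left i' =
      inj₂ (refl , subst₂ ℕ._<_ (FP.toℕ-↑ˡ i _) (FP.toℕ-↑ˡ i' _) i<i' , refl)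
    sorted (left i) (right j) _ rewrite lookup-left i | lookup-right j = inj₁ ℕ.z<s
    sorted (right j) (left i) j<i = ⊥-elim (ℕP.<-asym j<i
      (subst₂ ℕ._<_ (sym (FP.toℕ-↑ˡ i _)) (sym (FP.toℕ-↑ʳ e j))
        (ℕP.<-≤-trans (FP.toℕ<n i) (ℕP.m≤m+n e (toℕ j)))))
    sorted (right j) (right j') j<j' rewrite lookup-right j | lookup-right j' =
      shiftLabel-precedes v true (labelsRec-sorted v η j j'
        (ℕP.+-cancelˡ-< e _ _ (subst₂ ℕ._<_ (FP.toℕ-↑ʳ e j) (FP.toℕ-↑ʳ e j') j<j')))

  positions-sorted : ∀ {m} (v : Vec Bool m) (η : Vec ℕ (ones v)) (p p' : Fin (kOf v η)) → p F.< p' →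
                     (blockOf v η p F.< blockOf v η p')
                     ⊎ (blockOf v η p ≡ blockOf v η p' × partOf v η p ℕ.< partOf v η p'
                        × lookup v (blockOf v η p) ≡ true)
  positions-sorted v η p p' p<p' = labelsRec-sorted v η (castK v η p) (castK v η p')
    (subst₂ ℕ._<_ (sym (FP.toℕ-cast _ p)) (sym (FP.toℕ-cast _ p')) p<p')


-- Blocks of an m-sequence, restricted m-sequences and strong pairs of subsequences
module Subsequences where

  open import Defs
  open Rationals
  open FiniteSums
  open TournamentCounts
  open Arithmetic
  open import Data.Nat as ℕ using (ℕ; suc; _+_; _*_; z≤n)
  import Data.Nat.Properties as ℕP
  open import Data.Rational as ℚ using (ℚ)
  open import Data.Bool using (Bool; true; false; not; _∧_; _∨_)
  open import Data.Fin as F using (Fin)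
  import Data.Fin.Properties as FP
  open import Data.Vec using (Vec; lookup)
  open import Data.Product using (_×_; _,_; proj₁; proj₂; ∃)
  open import Data.Sum using (_⊎_; inj₁; inj₂)
  open import Function using (_∘_)
  import Data.Rational.Properties as ℚP
  open import Relation.Binary.PropositionalEquality
  open import Relation.Nullary using (yes; no)
  open import Relation.Nullary.Decidable using (dec-true)

  ∧-elimˡ : ∀ {a b} → (a ∧ b) ≡ true → a ≡ true
  ∧-elimˡ {true} _ = refl

  ∧-elimʳ : ∀ {a b} → (a ∧ b) ≡ true → b ≡ true
  ∧-elimʳ {true} ab = ab

  ∧-intro : ∀ {a b} → a ≡ true → b ≡ true → (a ∧ b) ≡ true
  ∧-intro refl refl = refl

  ∨-false : ∀ {a b} → (a ∨ b) ≡ false → a ≡ false × b ≡ false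
  ∨-false {false} b≡false = refl , b≡false

  not-true : ∀ {a} → not a ≡ true → a ≡ false
  not-true {false} _ = refl

  true≢false : true ≢ false
  true≢false ()

  module Blocks {m} (v : Vec Bool m) (η : Vec ℕ (ones v)) (T : Tournament) (Ts : Fin (kOf v η) → VSet (N T))
    (disjoint : ∀ j j' → j ≢ j' → Disjoint (Ts j) (Ts j')) where

    S : Fin m → VSet (N T)
    S = blockSet v η T Ts

    Ts⊆S : ∀ j x → Ts j x ≡ true → S (blockOf v η j) x ≡ true
    Ts⊆S j x Tsjx = anyFin-intro _ j (∧-intro (dec-true (blockOf v η j FP.≟ blockOf v η j) refl) Tsjx)

    S-elim : ∀ b x → S b x ≡ true → ∃ λ j → blockOf v η j ≡ b × Ts j x ≡ true
    S-elim b x Sbx with anyFin-elim _ Sbx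
    ... | j , hit with blockOf v η j FP.≟ b
    ...   | yes j∈b = j , j∈b , hit

    S-disjoint : ∀ b b' x → S b x ≡ true → S b' x ≡ true → b ≡ b'
    S-disjoint b b' x Sbx Sb'x with S-elim b x Sbx | S-elim b' x Sb'x
    ... | j , j∈b , Tsjx | j' , j'∈b' , Tsj'x with j FP.≟ j'
    ...   | yes refl = trans (sym j∈b) j'∈b'
    ...   | no j≢j' with trans (sym Tsj'x) (disjoint j j' j≢j' x Tsjx)
    ...     | ()

  -- Remove from every block S_b a set E_b of at most |S_b|/(2q) vertices,
  -- where c ≥ 1/q.  If, for i < i', every remaining vertex of S_i still has an out-neighbour among
  -- the remaining vertices of S_i', the remaining parts form a (v, η, 1/(2q), λ'')-m-sequence with
  -- λ'' = 1 - 1/(|T|² + 1) < 1: a single edge between two blocks is enough for that density.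
  module Restriction {m} (v : Vec Bool m) (η : Vec ℕ (ones v)) (T : Tournament) (t : ℕ) (isTr : IsTr T t)
    (Ts : Fin (kOf v η) → VSet (N T)) {c λ' : ℚ} (msq : IsMSeq v η c λ' T t Ts)
    (q' : ℕ) (c≥1/q : ∀ a b → c ℚ.* ℕ→ℚ a ℚ.≤ ℕ→ℚ b → a ℕ.≤ suc q' * b)
    (E : Fin m → VSet (N T)) where

    open Blocks v η T Ts (IsMSeq.disjoint msq)

    q : ℕ
    q = suc q'

    restrict : Fin (kOf v η) → VSet (N T)
    restrict j x = Ts j x ∧ not (E (blockOf v η j) x)

    restrict-block⊆ : ∀ b x → blockSet v η T restrict b x ≡ true → S b x ≡ true
    restrict-block⊆ b x in-block with anyFin-elim _ in-block
    ... | j , hit with blockOf v η j FP.≟ b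
    ...   | yes refl = Ts⊆S j x (∧-elimˡ {Ts j x} hit)

    restrict-block⊇ : ∀ b x → S b x ≡ true → E b x ≡ false → blockSet v η T restrict b x ≡ true
    restrict-block⊇ b x Sbx Ebx with S-elim b x Sbx
    ... | j , refl , Tsjx = anyFin-intro _ j (∧-intro (dec-true (blockOf v η j FP.≟ blockOf v η j) refl) (∧-intro Tsjx (cong not Ebx)))

    module _ (few-removed : ∀ b → card (λ x → S b x ∧ E b x) * double q ℕ.≤ card (S b))
             (forward : ∀ i i' → i F.< i' → ∀ y → S i y ≡ true → E i y ≡ false →
                        ∃ λ z → S i' z ≡ true × E i' z ≡ false × Edge T y z) where

      -- every nonempty block keeps a vertex (as |E_b| < |S_b|)
      survivor : ∀ b → Nonempty (S b) → ∃ λ y → S b y ≡ true × E b y ≡ false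
      survivor b (x , Sbx) = card-escape (S b) (E b)
        (subst (ℕ._< card (S b)) (ℕP.+-identityʳ _)
          (smallParts< q' _ 0 (card (S b)) (few-removed b) z≤n (card-member (S b) x Sbx)))

      restrict-bigPart : ∀ j → lookup v (blockOf v η j) ≡ true →
                         unitFrac (q' + q) ℚ.* ℕ→ℚ t ℚ.≤ ℕ→ℚ (card (restrict j))
      restrict-bigPart j v≡1 = unitFrac-scale (q' + q) t (card (restrict j))
        (keepsHalf t q (card (Ts j)) (card (restrict j)) _ (card (S b))
          (c≥1/q t (card (Ts j)) (IsMSeq.bigPart msq j v≡1)) Tsj≤ (few-removed b) |S|≤t)
        where
        b : Fin m
        b = blockOf v η j
        Tsj≤ : card (Ts j) ℕ.≤ card (restrict j) + card (λ x → S b x ∧ E b x)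
        Tsj≤ = ℕP.≤-trans (ℕP.≤-reflexive (card-split (Ts j) (E b)))
          (ℕP.+-monoʳ-≤ (card (restrict j)) (card-mono (λ x in-both →
            ∧-intro (Ts⊆S j x (∧-elimˡ in-both)) (∧-elimʳ {Ts j x} in-both))))
        |S|≤t : card (S b) ℕ.≤ t
        |S|≤t = proj₂ isTr (S b) (IsMSeq.transBlock msq b v≡1)

      restrict-bigBlock : ∀ b → lookup v b ≡ false →
                          unitFrac (q' + q) ℚ.* ℕ→ℚ (N T) ℚ.≤ ℕ→ℚ (card (blockSet v η T restrict b))
      restrict-bigBlock b v≡0 = unitFrac-scale (q' + q) (N T) (card (blockSet v η T restrict b))
        (ℕP.≤-trans
          (keepsHalf (N T) q (card (S b)) (card (λ x → S b x ∧ not (E b x))) _ (card (S b))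
            (c≥1/q (N T) (card (S b)) (IsMSeq.bigBlock msq b v≡0))
            (ℕP.≤-reflexive (card-split (S b) (E b))) (few-removed b) (card≤N (S b)))
          (ℕP.*-monoʳ-≤ (double q) (card-mono (λ x kept →
            restrict-block⊇ b x (∧-elimˡ kept) (not-true (∧-elimʳ {S b x} kept))))))

      -- the kept blocks are nonempty and joined by a forward edge
      restrict-dense : ∀ i i' → i F.< i' → DensityGE T (blockSet v η T restrict i) (blockSet v η T restrict i')
                                                       (ℚ.1ℚ ℚ.- nearlyOne (N T * N T))
      restrict-dense i i' i<i' = kept-nonempty i S-nonempty , kept-nonempty i' S'-nonempty ,
        nearlyOne-dense (N T * N T) (card Ri * card Ri') (eCount T Ri Ri')
          (ℕP.≤-trans (ℕP.*-mono-≤ (card≤N Ri) (card≤N Ri')) (ℕP.n≤1+n _)) one-edge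
        where
        Ri Ri' : VSet (N T)
        Ri  = blockSet v η T restrict i
        Ri' = blockSet v η T restrict i'
        S-nonempty : Nonempty (S i)
        S-nonempty = proj₁ (IsMSeq.dense msq i i' i<i')
        S'-nonempty : Nonempty (S i')
        S'-nonempty = proj₁ (proj₂ (IsMSeq.dense msq i i' i<i'))
        kept-nonempty : ∀ b → Nonempty (S b) → Nonempty (blockSet v η T restrict b)
        kept-nonempty b nonempty =
          let y , Sby , Eby = survivor b nonempty in y , restrict-block⊇ b y Sby Eby
        one-edge : 1 ℕ.≤ eCount T Ri Ri'
        one-edge =
          let y , Siy , Eiy      = survivor i S-nonempty
              z , Si'z , Ei'z , yz = forward i i' i<i' y Siy Eiy
          in edge⇒eCount-pos T Ri Ri' y z (restrict-block⊇ i y Siy Eiy) (restrict-block⊇ i' z Si'z Ei'z) yz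

      restrict-isMSeq : IsMSeq v η (unitFrac (q' + q)) (nearlyOne (N T * N T)) T t restrict
      restrict-isMSeq = record
        { disjoint   = λ j j' j≢j' x in-j → cong (_∧ not (E (blockOf v η j') x))
                                                 (IsMSeq.disjoint msq j j' j≢j' x (∧-elimˡ in-j))
        ; transBlock = λ b v≡1 → λ (ℓ , f , inj , in-block , path , closing) →
            IsMSeq.transBlock msq b v≡1 (ℓ , f , inj , (λ i → restrict-block⊆ b (f i) (in-block i)) , path , closing)
        ; ordered    = λ j j' same v≡1 a<a' x y x∈ y∈ →
            IsMSeq.ordered msq j j' same v≡1 a<a' x y (∧-elimˡ x∈) (∧-elimˡ y∈)
        ; bigPart    = restrict-bigPart
        ; bigBlock   = restrict-bigBlock
        ; dense      = restrict-dense
        }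


  strongPair-shrink : ∀ {k} (T : Tournament) t (Ts Ts' : Fin k → VSet (N T)) {c₀ c₁ : ℚ} → c₀ ℚ.≤ c₁ →
                      (∀ j x → Ts' j x ≡ true → Ts j x ≡ true) → HasStrongPair c₁ T t Ts' → HasStrongPair c₀ T t Ts
  strongPair-shrink T t Ts Ts' {c₀} {c₁} c₀≤c₁ Ts'⊆Ts (A , B , A∩B=∅ , A⊆ , B⊆ , A-big , B-big , complete) =
    A , B , A∩B=∅ , (λ x → ⊆V x ∘ A⊆ x) , (λ x → ⊆V x ∘ B⊆ x) , shrink (N T) (card A) A-big , B-big' B-big , complete
    where
    shrink : ∀ n s → c₁ ℚ.* ℕ→ℚ n ℚ.≤ ℕ→ℚ s → c₀ ℚ.* ℕ→ℚ n ℚ.≤ ℕ→ℚ s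
    shrink n s = ℚP.≤-trans (ℚP.*-monoʳ-≤-nonNeg (ℕ→ℚ n) {{ℕ→ℚ-nonNeg n}} c₀≤c₁)
    ⊆V : ∀ x → unionAll T Ts' x ≡ true → unionAll T Ts x ≡ true
    ⊆V x in-V with anyFin-elim (λ j → Ts' j x) in-V
    ... | j , Ts'jx = anyFin-intro (λ j → Ts j x) j (Ts'⊆Ts j x Ts'jx)
    B-big' : c₁ ℚ.* ℕ→ℚ (N T) ℚ.≤ ℕ→ℚ (card B) ⊎ (IsTransitive T B × c₁ ℚ.* ℕ→ℚ t ℚ.≤ ℕ→ℚ (card B))
           → c₀ ℚ.* ℕ→ℚ (N T) ℚ.≤ ℕ→ℚ (card B) ⊎ (IsTransitive T B × c₀ ℚ.* ℕ→ℚ t ℚ.≤ ℕ→ℚ (card B))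
    B-big' (inj₁ big)                = inj₁ (shrink (N T) (card B) big)
    B-big' (inj₂ (transitive , big)) = inj₂ (transitive , shrink t (card B) big)


-- The greedy embedding inside a fixed m-sequence
module GreedyEmbedding where

  open import Defs
  open Rationals
  open FiniteSums
  open TournamentCounts
  open Arithmetic
  open LongRepresentation
  open Subsequences
  open import Data.Nat as ℕ using (ℕ; zero; suc; _+_; _*_; _≤_; _<_; z≤n)
  import Data.Nat.Properties as ℕP
  open import Data.Rational as ℚ using (ℚ; 0ℚ; 1ℚ)
  open import Data.Bool using (Bool; true; false; not; _∧_; _∨_; if_then_else_)
  open import Data.Bool.Properties using (∨-comm; ∨-identityʳ; ∧-zeroʳ; ¬-not; T-≡)
  open import Function.Bundles using (Equivalence)
  open import Data.Fin as F using (Fin; zero; suc)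
  import Data.Fin.Properties as FP
  open import Data.Vec using (Vec; lookup)
  open import Data.List as L using (List; []; _∷_; length)
  open import Data.Bool.ListAction using (any)
  open import Data.List.Relation.Unary.All using (All; []; _∷_)
  open import Data.Product using (Σ; _×_; _,_; proj₁; proj₂; ∃)
  open import Data.Sum as Sum using (_⊎_; inj₁; inj₂)
  import Data.List.Properties as LP
  open import Relation.Binary using (Tri; tri<; tri≈; tri>)
  open import Relation.Binary.PropositionalEquality
  open import Relation.Nullary using (¬_)
  open import Data.Empty using (⊥-elim)
  import Data.List.Relation.Unary.All.Properties as AllP

  module Embedding {m} (v : Vec Bool m) (η : Vec ℕ (ones v)) (T : Tournament) (t : ℕ) (isTr : IsTr T t)
    (Ts : Fin (kOf v η) → VSet (N T)) {c λ' : ℚ} (msq : IsMSeq v η c λ' T t Ts)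
    (q' : ℕ) (c≥1/q : ∀ a b → c ℚ.* ℕ→ℚ a ℚ.≤ ℕ→ℚ b → a ≤ suc q' * b) (K : ℕ)
    (λ-small : λ' ℚ.≤ unitFrac (ℕ.pred (threshold (suc q') m * threshold (suc q') K))) where

    open Blocks v η T Ts (IsMSeq.disjoint msq)

    q M D : ℕ
    q = suc q'
    M = threshold q K
    D = threshold q m

    back-sparse : ∀ b b' → b F.< b' → D * M * eCount T (S b') (S b) ≤ card (S b) * card (S b')
    back-sparse b b' b<b' = fewReversePairs (ℕ.pred (D * M)) λ' λ-small _ _ _
      (proj₂ (proj₂ (IsMSeq.dense msq b b' b<b'))) (eCount-complement T (S b) (S b') S-b∩S-b'=∅)
      where
      S-b∩S-b'=∅ : Disjoint (S b) (S b')
      S-b∩S-b'=∅ x Sbx = ¬-not (λ Sb'x → ℕP.<-irrefl (cong F.toℕ (S-disjoint b b' x Sbx Sb'x)) b<b')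

    earlier : Fin m → Fin m → Bool
    earlier i j = F.toℕ i ℕ.<ᵇ F.toℕ j

    earlier-true : ∀ {i j} → i F.< j → earlier i j ≡ true
    earlier-true i<j = Equivalence.to T-≡ (ℕP.<⇒<ᵇ i<j)

    earlier-false : ∀ {i j} → ¬ (i F.< j) → earlier i j ≡ false
    earlier-false {i} {j} i≮j = ¬-not (λ i<j → i≮j (ℕP.<ᵇ⇒< (F.toℕ i) (F.toℕ j) (Equivalence.from T-≡ i<j)))

    -- The edge between y ∈ S_b and z ∈ S_b' points from the later block to the earlier one
    Backward : Fin m → Fin (N T) → Fin m → Fin (N T) → Bool
    Backward b y b' z = (earlier b' b ∧ adj T y z) ∨ (earlier b b' ∧ adj T z y)

    Backward-sym : ∀ b y b' z → Backward b y b' z ≡ Backward b' z b y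
    Backward-sym b y b' z = ∨-comm (earlier b' b ∧ adj T y z) (earlier b b' ∧ adj T z y)

    Backward-earlier : ∀ b y b' z → b' F.< b → Backward b y b' z ≡ adj T y z
    Backward-earlier b y b' z b'<b = begin
      (earlier b' b ∧ adj T y z) ∨ (earlier b b' ∧ adj T z y)
        ≡⟨ cong₂ (λ e e' → (e ∧ adj T y z) ∨ (e' ∧ adj T z y)) (earlier-true b'<b) (earlier-false (FP.<-asym b'<b)) ⟩
      adj T y z ∨ false
        ≡⟨ ∨-identityʳ (adj T y z) ⟩
      adj T y z ∎
      where open ≡-Reasoning

    Backward-later : ∀ b y b' z → b F.< b' → Backward b y b' z ≡ adj T z y
    Backward-later b y b' z b<b' = trans (Backward-sym b y b' z) (Backward-earlier b' z b y b<b')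

    Backward-same : ∀ b y z → Backward b y b z ≡ false
    Backward-same b y z = cong₂ (λ e e' → (e ∧ adj T y z) ∨ (e' ∧ adj T z y)) b≮b b≮b
      where
      b≮b : earlier b b ≡ false
      b≮b = earlier-false {b} {b} (FP.<-irrefl refl)

    backCount : Fin m → Fin (N T) → Fin m → ℕ
    backCount b y j = card (λ z → S j z ∧ Backward b y j z)

    backCount-total : ∀ b j → sumFin (λ y → if S b y then backCount b y j else 0)
                              ≡ sumFin (λ y → sumFin (λ z → ind (S b y ∧ S j z ∧ Backward b y j z)))
    backCount-total b j = sum-card (S b) (S j) (λ y z → Backward b y j z)

    backward : Fin m → Fin m → ℕ
    backward b j = sumFin (λ y → if S b y then backCount b y j else 0)

    backward-earlier : ∀ b j → j F.< b → backward b j ≡ eCount T (S b) (S j)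
    backward-earlier b j j<b = trans (backCount-total b j) (sumFin-cong λ y → sumFin-cong λ z →
      cong (λ e → ind (S b y ∧ S j z ∧ e)) (Backward-earlier b y j z j<b))

    backward-later : ∀ b j → b F.< j → backward b j ≡ eCount T (S j) (S b)
    backward-later b j b<j = begin
      backward b j
        ≡⟨ backCount-total b j ⟩
      sumFin (λ y → sumFin (λ z → ind (S b y ∧ S j z ∧ Backward b y j z)))
        ≡⟨ sumFin-cong (λ y → sumFin-cong λ z → cong (λ e → ind (S b y ∧ S j z ∧ e)) (Backward-later b y j z b<j)) ⟩
      sumFin (λ y → sumFin (λ z → ind (S b y ∧ S j z ∧ adj T z y)))
        ≡⟨ sumFin-comm (λ y z → ind (S b y ∧ S j z ∧ adj T z y)) ⟩
      sumFin (λ z → sumFin (λ y → ind (S b y ∧ S j z ∧ adj T z y)))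
        ≡⟨ sumFin-cong (λ z → sumFin-cong λ y → cong ind (swap-∧ (S b y) (S j z) (adj T z y))) ⟩
      eCount T (S j) (S b) ∎
      where
      open ≡-Reasoning
      swap-∧ : ∀ a b c → (a ∧ b ∧ c) ≡ (b ∧ a ∧ c)
      swap-∧ false false _ = refl
      swap-∧ false true  _ = refl
      swap-∧ true  false _ = refl
      swap-∧ true  true  _ = refl

    backward-same : ∀ b → backward b b ≡ 0
    backward-same b = trans (sumFin-cong (λ y → if-zero (S b y) (none-at y))) (sumFin-zero {N T})
      where
      none-at : ∀ y → backCount b y b ≡ 0
      none-at y = card-empty _ (λ z → trans (cong (S b z ∧_) (Backward-same b y z)) (∧-zeroʳ (S b z)))
      if-zero : ∀ s {n} → n ≡ 0 → (if s then n else 0) ≡ 0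
      if-zero true  n≡0 = n≡0
      if-zero false _   = refl

    few-backward : ∀ b j → D * M * backward b j ≤ card (S b) * card (S j)
    few-backward b j = by-order (FP.<-cmp j b)
      where
      by-order : Tri (j F.< b) (j ≡ b) (b F.< j) → D * M * backward b j ≤ card (S b) * card (S j)
      by-order (tri< j<b _ _) = subst₂ _≤_ (cong (D * M *_) (sym (backward-earlier b j j<b)))
                                          (ℕP.*-comm (card (S j)) (card (S b))) (back-sparse j b j<b)
      by-order (tri> _ _ b<j) = subst (_≤ card (S b) * card (S j)) (cong (D * M *_) (sym (backward-later b j b<j)))
                                      (back-sparse b j b<j)
      by-order (tri≈ _ j≡b _) = ℕP.≤-trans (ℕP.≤-reflexive (trans (cong (λ i → D * M * backward b i) j≡b)
                                  (trans (cong (D * M *_) (backward-same b)) (ℕP.*-zeroʳ (D * M))))) z≤n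

    atypical : Fin m → VSet (N T)
    atypical b y = anyFin (λ j → card (S j) ℕ.<ᵇ M * backCount b y j)

    typical-bound : ∀ b y → atypical b y ≡ false → ∀ j → backCount b y j * M ≤ card (S j)
    typical-bound b y typical j = subst (_≤ card (S j)) (ℕP.*-comm M (backCount b y j))
      (<ᵇ-false⇒≥ (card (S j)) (M * backCount b y j) few)
      where
      few : (card (S j) ℕ.<ᵇ M * backCount b y j) ≡ false
      few = ¬-not λ many → true≢false (trans (sym (anyFin-intro _ j many)) typical)

    few-atypical-toward : ∀ b j → card (λ y → S b y ∧ (card (S j) ℕ.<ᵇ M * backCount b y j)) * D ≤ card (S b)
    few-atypical-toward b j = markov-density (card (λ y → S b y ∧ (card (S j) ℕ.<ᵇ M * backCount b y j)))
      (card (S j)) M (backward b j) D (card (S b)) (markov (S b) (λ y → backCount b y j) M (card (S j))) (few-backward b j)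

    few-atypical : ∀ b → card (λ y → S b y ∧ atypical b y) * double (double q) ≤ card (S b)
    few-atypical b = ℕP.≤-trans (ℕP.*-monoˡ-≤ (double (double q)) (card-anyFin (S b) toward))
      (cancel-count (sumFin atypical-toward) (double (double q)) m m (card (S b))
        (sumFin-*≤ atypical-toward D (card (S b)) (few-atypical-toward b)) (ℕP.n≤1+n m))
      where
      toward : Fin (N T) → Fin m → Bool
      toward y j = card (S j) ℕ.<ᵇ M * backCount b y j
      atypical-toward : Fin m → ℕ
      atypical-toward j = card (λ y → S b y ∧ toward y j)

    Chosen : Set
    Chosen = List (Fin m × Fin (N T))

    -- the invariant of the construction: all chosen vertices are typical
    Typical : Fin m × Fin (N T) → Set
    Typical w = atypical (proj₁ w) (proj₂ w) ≡ false

    hits : Chosen → Fin m → VSet (N T)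
    hits W b y = any (λ w → Backward (proj₁ w) (proj₂ w) b y) W

    -- each typical chosen vertex rules out at most |S_b|/M vertices of S_b
    few-hit : ∀ W → All Typical W → ∀ b → card (λ y → S b y ∧ hits W b y) * M ≤ length W * card (S b)
    few-hit [] [] b = ℕP.≤-reflexive (cong (_* M) (card-empty (λ y → S b y ∧ false) (λ y → ∧-zeroʳ (S b y))))
    few-hit ((b' , w) ∷ W) (typical ∷ typicals) b = begin
      card (λ y → S b y ∧ (Backward b' w b y ∨ hits W b y)) * M
        ≤⟨ ℕP.*-monoˡ-≤ M (card-∨ (S b) (Backward b' w b) (hits W b)) ⟩
      (backCount b' w b + card (λ y → S b y ∧ hits W b y)) * M
        ≡⟨ ℕP.*-distribʳ-+ M (backCount b' w b) _ ⟩
      backCount b' w b * M + card (λ y → S b y ∧ hits W b y) * M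
        ≤⟨ ℕP.+-mono-≤ (typical-bound b' w typical b) (few-hit W typicals b) ⟩
      card (S b) + length W * card (S b) ∎
      where open ℕP.≤-Reasoning

    excluded : Chosen → Fin m → VSet (N T)
    excluded W b y = atypical b y ∨ hits W b y

    few-excluded : ∀ W → All Typical W → length W ≤ suc K →
                   ∀ b → card (λ y → S b y ∧ excluded W b y) * double q ≤ card (S b)
    few-excluded W typicals |W|≤ b = halves (double q) (card (λ y → S b y ∧ excluded W b y))
      (card (λ y → S b y ∧ atypical b y)) hit (card (S b)) (few-atypical b)
      (cancel-count hit (double (double q)) K (length W) (card (S b)) (few-hit W typicals b) |W|≤)
      (card-∨ (S b) (atypical b) (hits W b))
      where
      hit : ℕ
      hit = card (λ y → S b y ∧ hits W b y)

    -- For i < i', a kept vertex of S_i has a forward edge to a kept vertex of S_i': the vertices of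
    -- S_i' that are excluded or backward neighbours of y do not exhaust S_i'
    forward-edge : ∀ W → All Typical W → length W ≤ suc K → ∀ i i' → i F.< i' → ∀ y → S i y ≡ true →
                   excluded W i y ≡ false → ∃ λ z → S i' z ≡ true × excluded W i' z ≡ false × Edge T y z
    forward-edge W typicals |W|≤ i i' i<i' y Siy y-kept = found (card-escape (S i') bad room)
      where
      bad : VSet (N T)
      bad z = excluded W i' z ∨ Backward i y i' z
      backward-few : backCount i y i' * double (double q) ≤ card (S i')
      backward-few = ℕP.≤-trans (ℕP.*-monoʳ-≤ (backCount i y i') (ℕP.m≤m*n (double (double q)) (suc K)))
                                (typical-bound i y (proj₁ (∨-false y-kept)) i')
      S'-nonempty : Nonempty (S i')
      S'-nonempty = proj₁ (proj₂ (IsMSeq.dense msq i i' i<i'))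
      room : card (λ z → S i' z ∧ bad z) < card (S i')
      room = ℕP.≤-<-trans (card-∨ (S i') (excluded W i') (Backward i y i'))
        (smallParts< q' (card (λ z → S i' z ∧ excluded W i' z)) (backCount i y i') (card (S i'))
          (few-excluded W typicals |W|≤ i') backward-few
          (card-member (S i') (proj₁ S'-nonempty) (proj₂ S'-nonempty)))
      found : (∃ λ z → S i' z ≡ true × bad z ≡ false) → ∃ λ z → S i' z ≡ true × excluded W i' z ≡ false × Edge T y z
      found (z , Si'z , z-fine) = z , Si'z , proj₁ (∨-false z-fine) , forward
        where
        y≢z : y ≢ z
        y≢z refl = ℕP.<-irrefl (cong F.toℕ (S-disjoint i i' y Siy Si'z)) i<i'
        forward : Edge T y z
        forward = trans (tourn T y z y≢z)
          (cong not (trans (sym (Backward-later i y i' z i<i')) (proj₂ (∨-false {excluded W i' z} z-fine))))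

    kept : Chosen → Fin (kOf v η) → VSet (N T)
    kept W = Restriction.restrict v η T t isTr Ts msq q' c≥1/q (excluded W)

    kept-isMSeq : ∀ W → All Typical W → length W ≤ suc K →
                  IsMSeq v η (unitFrac (q' + q)) (nearlyOne (N T * N T)) T t (kept W)
    kept-isMSeq W typicals |W|≤ = Restriction.restrict-isMSeq v η T t isTr Ts msq q' c≥1/q (excluded W)
      (few-excluded W typicals |W|≤) (forward-edge W typicals |W|≤)

    -- For positions p' < p of l(χ), a vertex y ∈ T_p has no edge to z ∈ T_p' unless that edge is
    -- backward between different blocks: within a transitive block the earlier part is complete to
    -- the later one.
    no-edge-back : ∀ p p' → p' F.< p → ∀ y z → Ts p y ≡ true → Ts p' z ≡ true →
                   Backward (blockOf v η p) y (blockOf v η p') z ≡ false → adj T y z ≡ false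
    no-edge-back p p' p'<p y z Tspy Tsp'z not-backward = by-position (positions-sorted v η p' p p'<p)
      where
      y≢z : y ≢ z
      y≢z y≡z = true≢false (trans (sym (subst (λ u → Ts p' u ≡ true) (sym y≡z) Tsp'z))
        (IsMSeq.disjoint msq p p' (λ p≡p' → ℕP.<-irrefl (cong F.toℕ (sym p≡p')) p'<p) y Tspy))
      by-position : (blockOf v η p' F.< blockOf v η p)
                    ⊎ (blockOf v η p' ≡ blockOf v η p × partOf v η p' < partOf v η p
                       × lookup v (blockOf v η p') ≡ true) → adj T y z ≡ false
      by-position (inj₁ earlier-block) = trans (sym (Backward-earlier _ y _ z earlier-block)) not-backward
      by-position (inj₂ (same-block , earlier-part , v≡1)) =
        trans (tourn T y z y≢z) (cong not (IsMSeq.ordered msq p' p same-block v≡1 earlier-part z y Tsp'z Tspy))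

    IsEmbedding : ∀ r (n : Fin r → ℕ) (Dg : ∀ i → Digraph (n i)) (φ : ∀ i → Fin (n i) → Fin (kOf v η)) →
                  ((i : Fin r) → Fin (n i) → Fin (N T)) → Set
    IsEmbedding r n Dg φ x = (∀ i a → Ts (φ i a) (x i a) ≡ true)
                           × (∀ i a b → Dg i a b ≡ true → Edge T (x i a) (x i b))
                           × (∀ i i' → i ≢ i' → ∀ a b → φ i' b F.< φ i a → adj T (x i a) (x i' b) ≡ false)

    Avoids : Chosen → ∀ r (n : Fin r → ℕ) (φ : ∀ i → Fin (n i) → Fin (kOf v η)) →
             ((i : Fin r) → Fin (n i) → Fin (N T)) → Set
    Avoids W r n φ x = ∀ i a → All (λ w → Backward (proj₁ w) (proj₂ w) (blockOf v η (φ i a)) (x i a) ≡ false) W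

    placed : ∀ {n} → (Fin n → Fin (kOf v η)) → (Fin n → Fin (N T)) → Chosen
    placed φ x = L.tabulate (λ a → blockOf v η (φ a) , x a)

    any-false : ∀ {A : Set} (p : A → Bool) xs → any p xs ≡ false → All (λ x → p x ≡ false) xs
    any-false p []       _       = []
    any-false p (x ∷ xs) nothing = proj₁ (∨-false nothing) ∷ any-false p xs (proj₂ (∨-false nothing))

    kept⇒in : ∀ W j x → kept W j x ≡ true → Ts j x ≡ true
    kept⇒in W j x x-kept = ∧-elimˡ x-kept

    kept⇒not-excluded : ∀ W j x → kept W j x ≡ true → excluded W (blockOf v η j) x ≡ false
    kept⇒not-excluded W j x x-kept = not-true (∧-elimʳ {Ts j x} x-kept)

    prepend : ∀ r (n : Fin (suc r) → ℕ) (Dg : ∀ i → Digraph (n i)) (φ : ∀ i → Fin (n i) → Fin (kOf v η)) W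
              (x₀ : Fin (n zero) → Fin (N T)) → (∀ a → kept W (φ zero a) (x₀ a) ≡ true) →
              (∀ a b → Dg zero a b ≡ true → Edge T (x₀ a) (x₀ b)) →
              (Σ ((i : Fin r) → Fin (n (suc i)) → Fin (N T)) λ xs →
                 IsEmbedding r (λ i → n (suc i)) (λ i → Dg (suc i)) (λ i → φ (suc i)) xs
               × Avoids (W L.++ placed (φ zero) x₀) r (λ i → n (suc i)) (λ i → φ (suc i)) xs) →
              Σ ((i : Fin (suc r)) → Fin (n i) → Fin (N T)) λ x → IsEmbedding (suc r) n Dg φ x × Avoids W (suc r) n φ x
    prepend r n Dg φ W x₀ x₀-kept x₀-edges (xs , (xs-in , xs-edges , xs-cross) , xs-avoid) =
      x , (x-in , x-edges , x-cross) , x-avoid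
      where
      x : (i : Fin (suc r)) → Fin (n i) → Fin (N T)
      x zero    = x₀
      x (suc i) = xs i
      x₀-in : ∀ a → Ts (φ zero a) (x₀ a) ≡ true
      x₀-in a = kept⇒in W (φ zero a) (x₀ a) (x₀-kept a)
      x-in : ∀ i a → Ts (φ i a) (x i a) ≡ true
      x-in zero    = x₀-in
      x-in (suc i) = xs-in i
      x-edges : ∀ i a b → Dg i a b ≡ true → Edge T (x i a) (x i b)
      x-edges zero    = x₀-edges
      x-edges (suc i) = xs-edges i
      x-avoid : Avoids W (suc r) n φ x
      x-avoid zero    a = any-false _ W (proj₂ (∨-false (kept⇒not-excluded W (φ zero a) (x₀ a) (x₀-kept a))))
      x-avoid (suc i) a = AllP.++⁻ˡ W (xs-avoid i a)
      avoids-x₀ : ∀ i b a → Backward (blockOf v η (φ zero a)) (x₀ a) (blockOf v η (φ (suc i) b)) (xs i b) ≡ false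
      avoids-x₀ i b = AllP.tabulate⁻ (AllP.++⁻ʳ W (xs-avoid i b))
      x-cross : ∀ i i' → i ≢ i' → ∀ a b → φ i' b F.< φ i a → adj T (x i a) (x i' b) ≡ false
      x-cross zero    zero     i≢i' = ⊥-elim (i≢i' refl)
      x-cross (suc i) (suc i') i≢i' = xs-cross i i' (λ i≡i' → i≢i' (cong suc i≡i'))
      x-cross zero    (suc i') _ a b later =
        no-edge-back (φ zero a) (φ (suc i') b) later (x₀ a) (xs i' b) (x₀-in a) (xs-in i' b) (avoids-x₀ i' b a)
      x-cross (suc i) zero     _ a b later =
        no-edge-back (φ (suc i) a) (φ zero b) later (xs i a) (x₀ b) (xs-in i a) (x₀-in b)
          (trans (Backward-sym (blockOf v η (φ (suc i) a)) (xs i a) (blockOf v η (φ zero b)) (x₀ b)) (avoids-x₀ i a b))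

    c' : ℚ
    c' = unitFrac (q' + q)

    EmbedsOrStrong : ∀ {n} → Digraph n → (Fin n → Fin (kOf v η)) → ℚ → Set
    EmbedsOrStrong {n} Dg φ c₁ =
      ∀ (λ'' : ℚ) → 0ℚ ℚ.≤ λ'' → λ'' ℚ.< 1ℚ → ∀ (Ts' : Fin (kOf v η) → VSet (N T)) → IsMSeq v η c' λ'' T t Ts' →
        (Σ (Fin n → Fin (N T)) λ x → (∀ a → Ts' (φ a) (x a) ≡ true) × (∀ a b → Dg a b ≡ true → Edge T (x a) (x b)))
        ⊎ HasStrongPair c₁ T t Ts'

    Outcome : Chosen → ∀ r (n : Fin r → ℕ) (Dg : ∀ i → Digraph (n i)) (φ : ∀ i → Fin (n i) → Fin (kOf v η)) → ℚ → Set
    Outcome W r n Dg φ c₁ = HasStrongPair c₁ T t Ts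
      ⊎ Σ ((i : Fin r) → Fin (n i) → Fin (N T)) λ x → IsEmbedding r n Dg φ x × Avoids W r n φ x

    greedy : ∀ r (n : Fin r → ℕ) (Dg : ∀ i → Digraph (n i)) (φ : ∀ i → Fin (n i) → Fin (kOf v η)) (cs : Fin r → ℚ) →
             (∀ i → EmbedsOrStrong (Dg i) (φ i) (cs i)) → ∀ c₁ → (∀ i → c₁ ℚ.≤ cs i) →
             ∀ W → All Typical W → length W + sumFin n ≤ suc K → Outcome W r n Dg φ c₁
    greedy zero    n Dg φ cs proper c₁ c₁≤ W typicals room = inj₂ ((λ ()) , ((λ ()) , (λ ()) , (λ ())) , (λ ()))
    greedy (suc r) n Dg φ cs proper c₁ c₁≤ W typicals room =
      continue (proper zero (nearlyOne (N T * N T)) (nearlyOne-nonNeg (N T * N T)) (nearlyOne<1 (N T * N T))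
                       (kept W) (kept-isMSeq W typicals (ℕP.m+n≤o⇒m≤o (length W) room)))
      where
      continue : (Σ (Fin (n zero) → Fin (N T)) λ x → (∀ a → kept W (φ zero a) (x a) ≡ true)
                   × (∀ a b → Dg zero a b ≡ true → Edge T (x a) (x b)))
                 ⊎ HasStrongPair (cs zero) T t (kept W) → Outcome W (suc r) n Dg φ c₁
      continue (inj₂ strong) = inj₁ (strongPair-shrink T t Ts (kept W) (c₁≤ zero) (kept⇒in W) strong)
      continue (inj₁ (x₀ , x₀-kept , x₀-edges)) = Sum.map₂ (prepend r n Dg φ W x₀ x₀-kept x₀-edges)
        (greedy r (λ i → n (suc i)) (λ i → Dg (suc i)) (λ i → φ (suc i)) (λ i → cs (suc i)) (λ i → proper (suc i))
                c₁ (λ i → c₁≤ (suc i)) (W L.++ E) typicals' room')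
        where
        E : Chosen
        E = placed (φ zero) x₀
        typicals' : All Typical (W L.++ E)
        typicals' = AllP.++⁺ typicals (AllP.tabulate⁺ λ a →
                      proj₁ (∨-false (kept⇒not-excluded W (φ zero a) (x₀ a) (x₀-kept a))))
        room' : length (W L.++ E) + sumFin (λ i → n (suc i)) ≤ suc K
        room' = ℕP.≤-trans (ℕP.≤-reflexive (begin
          length (W L.++ E) + sumFin (λ i → n (suc i))       ≡⟨ cong (_+ sumFin (λ i → n (suc i)))
                                                                (trans (LP.length-++ W) (cong (length W +_) (LP.length-tabulate _))) ⟩
          length W + n zero + sumFin (λ i → n (suc i))       ≡⟨ ℕP.+-assoc (length W) (n zero) _ ⟩
          length W + sumFin n                                ∎)) room
          where open ≡-Reasoning

open import Defs
open import Data.Nat using (ℕ)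
open import Data.Rational using (ℚ; 0ℚ; _<_; _≤_)
open import Data.Bool using (Bool; true; false)
open import Data.Fin using (Fin)
open import Data.Vec using (Vec)
open import Data.Vec.Relation.Unary.All using (All)
open import Data.Product using (Σ; _×_; _,_; proj₁; proj₂)
open import Data.Sum using (_⊎_; map₂)
open import Data.List using ([])
open import Data.List.Relation.Unary.All using ([])
open import Relation.Binary.PropositionalEquality using (_≡_; _≢_)
open import Function.Definitions using (Injective)
open import Data.Nat.Properties using (n≤1+n)
open Rationals using (fractionBound; unitFrac; unitFrac-pos; minimum; minimum≤; minimum-pos)
open Arithmetic using (threshold)
open GreedyEmbedding using (module Embedding)

theorem13 : ∀ {m} (v : Vec Bool m) (η : Vec ℕ (ones v)) → All (Data.Nat._<_ 0) η
  → (r : ℕ) (n : Fin r → ℕ) (D : (i : Fin r) → Digraph (n i))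
  → (φ : (i : Fin r) → Fin (n i) → Fin (kOf v η))
  → (∀ i → Injective _≡_ _≡_ (φ i))
  → (∀ i i' → i ≢ i' → ∀ a b → φ i a ≢ φ i' b)
  → (∀ i → IsProper v η (D i) (φ i))
  → ∀ (c : ℚ) → 0ℚ < c →
    Σ ℚ λ λ₀ → Σ ℚ λ c₁ → 0ℚ < λ₀ × 0ℚ < c₁ ×
     (∀ (T : Tournament) (t : ℕ) → IsTr T t →
      ∀ (λ' : ℚ) → 0ℚ < λ' → λ' ≤ λ₀ →
      ∀ (Ts : Fin (kOf v η) → VSet (N T)) → IsMSeq v η c λ' T t Ts →
        HasStrongPair c₁ T t Ts
        ⊎ (Σ ((i : Fin r) → Fin (n i) → Fin (N T)) λ x →
              (∀ i a → Ts (φ i a) (x i a) ≡ true)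
            × (∀ i a b → D i a b ≡ true → Edge T (x i a) (x i b))
            × (∀ i i' → i ≢ i' → ∀ a b → φ i' b Data.Fin.< φ i a
                 → adj T (x i a) (x i' b) ≡ false)))
theorem13 {m} v η _ r n D φ _ _ proper c 0<c =
  λ₀ , c₁ , unitFrac-pos L , minimum-pos cs cs-pos ,
  λ T t isTr λ' _ λ'≤λ₀ Ts msq →
    let open Embedding v η T t isTr Ts msq q' (proj₂ (fractionBound c 0<c)) K λ'≤λ₀ using (greedy) in
    map₂ (λ (x , embedding , _) → x , embedding)
      (greedy r n D φ cs (λ i → proj₂ (proj₂ (proper i c' c'-pos)) T t isTr) c₁ (minimum≤ cs) [] [] (n≤1+n K))
  where
  -- c ≥ 1/q for q = q' + 1, and at most K + 1 vertices are ever chosen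
  q' K L : ℕ
  q' = proj₁ (fractionBound c 0<c)
  K  = sumFin n
  L  = Data.Nat.pred (threshold (Data.Nat.suc q') m Data.Nat.* threshold (Data.Nat.suc q') K)
  -- λ₀ = 1/(D·M); the restricted sequences have constant c' = 1/(2q), for which properness of
  -- D_i yields the constant cs i
  λ₀ c' : ℚ
  λ₀ = unitFrac L
  c' = unitFrac (q' Data.Nat.+ Data.Nat.suc q')
  c'-pos : 0ℚ < c'
  c'-pos = unitFrac-pos (q' Data.Nat.+ Data.Nat.suc q')
  cs : Fin r → ℚ
  cs i = proj₁ (proper i c' c'-pos)
  cs-pos : ∀ i → 0ℚ < cs i
  cs-pos i = proj₁ (proj₂ (proper i c' c'-pos))
  c₁ : ℚ
  c₁ = minimum cs
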